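{- Let $\mathcal{G},\mathcal{H}$ be graph classes, where $\mathcal{G}$ contains $K_2$. Then $\mathcal{H}$ is $(c^{\mathcal{G}}_{\mathrm l},c^{\mathcal{G}}_{\mathrm f})$-bounded provided one of the following holds: (1) $\mathcal{G}$ is hereditary and has bounded maximum average degree; (2) $\mathcal{G}$ is hereditary and $\mathcal{H}$ has bounded chromatic number. Moreover, in each of the following cases there exist graph classes $\mathcal{G}$ (containing $K_2$) and $\mathcal{H}$ satisfying the stated conditions such that $\mathcal{H}$ is not $(c^{\mathcal{G}}_{\mathrm l},c^{\mathcal{G}}_{\mathrm f})$-bounded: (a) $\mathcal{G}$ is monotone and has bounded chromatic number; (b) $\mathcal{G}$ is component-closed and $\mathcal{H}$ has bounded treewidth.
   Context: All graphs are finite and simple. For graphs $G,H$, a homomorphism $\varphi\colon G\to H$ is a map $V(G)\to V(H)$ with $\varphi(u)\varphi(v)\in E(H)$ whenever $uv\in E(G)$. $\dot\cup$ denotes vertex-disjoint union. For a graph class $\mathcal{G}$ and a graph $H$, a $\mathcal{G}$-cover of $H$ is an edge-surjective homomorphism $\varphi\colon G_1\dot\cup\cdots\dot\cup G_t\to H$ with all $G_i\in\mathcal{G}$; it is injective if each $\varphi|_{G_i}$ is injective, and $s$-local if $|\varphi^{ -1}(v)|\le s$ for all $v\in V(H)$. $c^{\mathcal{G}}_{\mathrm l}(H)$ is the least $s$ such that $H$ has an $s$-local injective $\mathcal{G}$-cover; $c^{\mathcal{G}}_{\mathrm f}(H)$ is the least $s$ such that $H$ has an $s$-local (not necessarily injective)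 $\mathcal{G}$-cover. $\mathcal{H}$ is $(c^{\mathcal{G}}_{\mathrm l},c^{\mathcal{G}}_{\mathrm f})$-bounded if there is $f\colon\mathbb{N}\to\mathbb{R}_{\ge0}$ with $c^{\mathcal{G}}_{\mathrm f}(H)\le c^{\mathcal{G}}_{\mathrm l}(H)\le f(c^{\mathcal{G}}_{\mathrm f}(H))$ for all $H\in\mathcal{H}$. A class is monotone if closed under subgraphs, hereditary if closed under induced subgraphs, component-closed if every connected component of every member is a member. For a graph parameter $p$, a class has bounded $p$ if the supremum of $p$ over the class is finite. $\mathrm{mad}(G)=\max\{2|E(G')|/|V(G')| : G'\subseteq G,\ |V(G')|>0\}$. -}

module Defs where

open import Data.Nat using (ℕ; zero; suc; _+_; _*_; _≤_; _<_; _<ᵇ_)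
open import Data.Bool using (Bool; true; false; _∧_; if_then_else_)
open import Data.Fin using (Fin; zero; suc; toℕ; inject₁; fromℕ; _≟_)
open import Data.List using (List; []; _∷_)
open import Data.List.Relation.Unary.All using (All)
open import Data.List.Relation.Unary.Any using (Any)
open import Data.Product using (Σ; ∃; ∃-syntax; _×_; _,_)
open import Data.Unit using (⊤)
open import Relation.Nullary using (¬_)
open import Relation.Nullary.Decidable using (⌊_⌋)
open import Relation.Binary.PropositionalEquality using (_≡_; refl)
open import Function.Definitions using (Injective)

record Graph : Set where
  field
    size   : ℕ
    adj    : Fin size → Fin size → Bool
    sym    : ∀ i j → adj i j ≡ adj j i
    irrefl : ∀ i → adj i i ≡ false
open Graph public

Class : Set₁
Class = Graph → Set

sumFin : ∀ {n} → (Fin n → ℕ) → ℕ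
sumFin {zero}  f = 0
sumFin {suc n} f = f zero + sumFin (λ i → f (suc i))

countFin : ∀ {n} → (Fin n → Bool) → ℕ
countFin p = sumFin (λ i → if p i then 1 else 0)

numEdges : Graph → ℕ
numEdges G = sumFin (λ i → countFin (λ j → (toℕ j <ᵇ toℕ i) ∧ adj G i j))

K2adj : Fin 2 → Fin 2 → Bool
K2adj zero    zero    = false
K2adj zero    (suc _) = true
K2adj (suc _) zero    = true
K2adj (suc _) (suc _) = false

K2sym : ∀ i j → K2adj i j ≡ K2adj j i
K2sym zero    zero    = refl
K2sym zero    (suc _) = refl
K2sym (suc _) zero    = refl
K2sym (suc _) (suc _) = refl

K2irr : ∀ i → K2adj i i ≡ false
K2irr zero    = refl
K2irr (suc _) = refl

K2 : Graph
K2 = record { size = 2 ; adj = K2adj ; sym = K2sym ; irrefl = K2irr }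

SubgraphOf : Graph → Graph → Set
SubgraphOf H G =
  Σ (Fin (size H) → Fin (size G)) λ f →
    Injective _≡_ _≡_ f × (∀ i j → adj H i j ≡ true → adj G (f i) (f j) ≡ true)

InducedSubgraphOf : Graph → Graph → Set
InducedSubgraphOf H G =
  Σ (Fin (size H) → Fin (size G)) λ f →
    Injective _≡_ _≡_ f × (∀ i j → adj H i j ≡ adj G (f i) (f j))

data Walk (G : Graph) (P : Fin (size G) → Set) : Fin (size G) → Fin (size G) → Set where
  here : ∀ {x} → P x → Walk G P x x
  step : ∀ {x y z} → P x → adj G x y ≡ true → Walk G P y z → Walk G P x z

Connected : Graph → Set
Connected G = ∀ x y → Walk G (λ _ → ⊤) x y

ComponentOf : Graph → Graph → Set
ComponentOf C G =
  Σ (Fin (size C) → Fin (size G)) λ f →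
    Injective _≡_ _≡_ f
    × (∀ i j → adj C i j ≡ adj G (f i) (f j))
    × (∀ i y → adj G (f i) y ≡ true → ∃[ j ] f j ≡ y)
    × Connected C
    × 0 < size C

Monotone : Class → Set
Monotone 𝒢 = ∀ G H → 𝒢 G → SubgraphOf H G → 𝒢 H

Hereditary : Class → Set
Hereditary 𝒢 = ∀ G H → 𝒢 G → InducedSubgraphOf H G → 𝒢 H

ComponentClosed : Class → Set
ComponentClosed 𝒢 = ∀ G C → 𝒢 G → ComponentOf C G → 𝒢 C

MadAtMost : Graph → ℕ → Set
MadAtMost G D = ∀ G' → SubgraphOf G' G → 0 < size G' → 2 * numEdges G' ≤ D * size G'

BoundedMad : Class → Set
BoundedMad 𝒢 = ∃[ D ] (∀ G → 𝒢 G → MadAtMost G D)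

Colourable : Graph → ℕ → Set
Colourable G k = Σ (Fin (size G) → Fin k) λ c → ∀ i j → adj G i j ≡ true → ¬ (c i ≡ c j)

BoundedChromatic : Class → Set
BoundedChromatic 𝒢 = ∃[ k ] (∀ G → 𝒢 G → Colourable G k)

-- a cycle of length k+3
HasCycle : Graph → Set
HasCycle G =
  Σ ℕ λ k → Σ (Fin (suc (suc (suc k))) → Fin (size G)) λ c →
    Injective _≡_ _≡_ c
    × (∀ (i : Fin (suc (suc k))) → adj G (c (inject₁ i)) (c (suc i)) ≡ true)
    × adj G (c (fromℕ (suc (suc k)))) (c zero) ≡ true

IsTree : Graph → Set
IsTree T = Connected T × ¬ HasCycle T

-- tree decomposition of H of width ≤ k (all bags of size ≤ k+1)
record TreeDecomposition (H : Graph) (k : ℕ) : Set where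
  field
    T        : Graph
    isTree   : IsTree T
    bag      : Fin (size T) → Fin (size H) → Bool
    vcover   : ∀ v → ∃[ t ] bag t v ≡ true
    ecover   : ∀ u v → adj H u v ≡ true → ∃[ t ] (bag t u ≡ true × bag t v ≡ true)
    subtree  : ∀ v t t' → bag t v ≡ true → bag t' v ≡ true → Walk T (λ s → bag s v ≡ true) t t'
    bagSize  : ∀ t → countFin (bag t) ≤ suc k

BoundedTreewidth : Class → Set
BoundedTreewidth ℋ = ∃[ k ] (∀ H → ℋ H → TreeDecomposition H k)

-- one component G_i of the disjoint union, with φ restricted to it
record Piece (𝒢 : Class) (H : Graph) : Set where
  field
    G   : Graph
    mem : 𝒢 G
    φ   : Fin (size G) → Fin (size H)
    hom : ∀ x y → adj G x y ≡ true → adj H (φ x) (φ y) ≡ true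
open Piece public

-- a 𝒢-cover φ : G₁ ∪̇ ⋯ ∪̇ Gₜ → H (edge-surjective homomorphism)
record Cover (𝒢 : Class) (H : Graph) : Set where
  field
    pieces : List (Piece 𝒢 H)
    surj   : ∀ u v → adj H u v ≡ true →
             Any (λ p → ∃[ x ] ∃[ y ] (adj (G p) x y ≡ true × φ p x ≡ u × φ p y ≡ v)) pieces
open Cover public

preimageSize : ∀ {𝒢 H} → List (Piece 𝒢 H) → Fin (size H) → ℕ
preimageSize []       v = 0
preimageSize (p ∷ ps) v = countFin (λ x → ⌊ φ p x ≟ v ⌋) + preimageSize ps v

IsLocal : ∀ {𝒢 H} → Cover 𝒢 H → ℕ → Set
IsLocal C s = ∀ v → preimageSize (pieces C) v ≤ s

IsInjectiveCover : ∀ {𝒢 H} → Cover 𝒢 H → Set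
IsInjectiveCover C = All (λ p → Injective _≡_ _≡_ (φ p)) (pieces C)

HasInjLocalCover : Class → Graph → ℕ → Set
HasInjLocalCover 𝒢 H s = Σ (Cover 𝒢 H) λ C → IsInjectiveCover C × IsLocal C s

HasLocalCover : Class → Graph → ℕ → Set
HasLocalCover 𝒢 H s = Σ (Cover 𝒢 H) λ C → IsLocal C s

IsCl : Class → Graph → ℕ → Set
IsCl 𝒢 H s = HasInjLocalCover 𝒢 H s × (∀ s' → HasInjLocalCover 𝒢 H s' → s ≤ s')

IsCf : Class → Graph → ℕ → Set
IsCf 𝒢 H s = HasLocalCover 𝒢 H s × (∀ s' → HasLocalCover 𝒢 H s' → s ≤ s')

LFBounded : Class → Class → Set
LFBounded 𝒢 ℋ =
  Σ (ℕ → ℕ) λ f → ∀ H → ℋ H → ∀ a b → IsCl 𝒢 H a → IsCf 𝒢 H b → b ≤ a × a ≤ f b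

-- Take a b-local 𝒢-cover φ of H and a proper k-colouring col of H. In a piece,
-- the rank r x of x among the preimages of φ x is below b. For each (i , c , j) keep the vertices x with
-- r x = j if col (φ x) = c and r x = i otherwise: φ is injective on this induced subgraph, which lies in
-- 𝒢 as 𝒢 is hereditary, and an edge xy over uv survives for (r x , col v , r y) since col u ≠ col v.
-- This gives an injective (b · k · b) · b-local cover. Under (2) k is bounded; under (1), pulling edges
-- back along the cover bounds the average degree of every induced subgraph of H by D · b, so H is
-- (D · b)-degenerate and greedily (D · b + 1)-colourable.
--
-- Counterexamples. (a) The bipartite double cover of Kₙ is a 2-local cover by bipartite graphs, whereas
-- the pieces of an injective s-local cover induce partial 2-colourings of Kₙ separating all pairs of
-- vertices, and a Kraft-type inequality gives n ≤ 2 ^ s. (b) In the component-closed class of graphs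
-- in which every path of length two lies in a 4-cycle, K_{2,n} folded onto the star K_{1,n} is a
-- 2-local cover, while an injective piece covers at most one edge of the star, forcing locality n.

module Submission where

open import Defs hiding (sym)

open import Data.Bool using (Bool; true; false; T; _∧_; _∨_; not; if_then_else_)
open import Data.Bool.Properties using (∧-zeroʳ; ∧-identityʳ; ∧-conicalˡ; ∧-conicalʳ)
  renaming (_≟_ to _≟ᵇ_)
open import Data.Empty using (⊥)
open import Data.Fin using (Fin; zero; suc; toℕ; fromℕ<; _≟_; splitAt; _↑ˡ_; _↑ʳ_)
open import Data.Fin.Properties
  using (suc-injective; toℕ-injective; toℕ-fromℕ<; any?; pigeonhole; splitAt-↑ˡ; splitAt-↑ʳ)
  renaming (<⇒≢ to <⇒≢ᶠ)
open import Data.List using (List; []; _∷_; _++_; map; concatMap; allFin; length; cartesianProduct)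
open import Data.List.Membership.Propositional using (_∈_)
open import Data.List.Membership.Propositional.Properties using (∈-allFin; ∈-cartesianProduct⁺)
open import Data.List.Properties using (length-++; length-map; length-tabulate)
open import Data.List.Relation.Unary.All using (All; []; _∷_; universal)
import Data.List.Relation.Unary.All.Properties as Allₚ
open import Data.List.Relation.Unary.Any as Any using (Any; here; there)
import Data.List.Relation.Unary.Any.Properties as Anyₚ
open import Data.Nat using (ℕ; zero; suc; _+_; _*_; _^_; _≤_; _<_; _<ᵇ_; z≤n; s≤s; _≤?_; _<?_; _⊔_)
  renaming (_≟_ to _≟ℕ_)
open import Data.Nat.Induction using (<-rec)
open import Data.Nat.Properties hiding (suc-injective; _≟_)
open import Algebra.Properties.CommutativeSemigroup *-commutativeSemigroup using (x∙yz≈y∙xz)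
open import Algebra.Properties.Semiring.Sum +-*-semiring
  using (sum; sum-cong-≗; ∑-distrib-+; ∑-comm; *-distribˡ-sum; *-distribʳ-sum)
open import Data.Product using (Σ; ∃; ∃-syntax; _×_; _,_; proj₁; proj₂)
open import Data.Sum using (_⊎_; inj₁; inj₂; [_,_]′)
open import Data.Unit using (⊤; tt)
open import Function using (_∘_; id; const)
open import Function.Definitions using (Injective)
open import Relation.Binary using (tri<; tri≈; tri>)
open import Relation.Binary.PropositionalEquality
open import Relation.Nullary using (¬_; ¬?; Dec; yes; no; contradiction)
open import Relation.Nullary.Decidable using (⌊_⌋; _×-dec_; decidable-stable)

𝟙 : Bool → ℕ
𝟙 b = if b then 1 else 0

𝟙≤1 : ∀ b → 𝟙 b ≤ 1
𝟙≤1 true  = ≤-refl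
𝟙≤1 false = z≤n

𝟙-∧≤ʳ : ∀ a b → 𝟙 (a ∧ b) ≤ 𝟙 b
𝟙-∧≤ʳ true  b = ≤-refl
𝟙-∧≤ʳ false b = z≤n

𝟙-∧≤ˡ : ∀ a b → 𝟙 (a ∧ b) ≤ 𝟙 a
𝟙-∧≤ˡ true  b = 𝟙≤1 b
𝟙-∧≤ˡ false b = z≤n

⌊⌋⇒ : ∀ {A : Set} (a? : Dec A) → ⌊ a? ⌋ ≡ true → A
⌊⌋⇒ (yes a) _ = a

⌊⌋-true : ∀ {A : Set} (a? : Dec A) → A → ⌊ a? ⌋ ≡ true
⌊⌋-true (yes _) _ = refl
⌊⌋-true (no ¬a) a = contradiction a ¬a

⌊⌋-false : ∀ {A : Set} (a? : Dec A) → ¬ A → ⌊ a? ⌋ ≡ false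
⌊⌋-false (yes a) ¬a = contradiction a ¬a
⌊⌋-false (no _)  _  = refl

sumFin≡sum : ∀ {n} (f : Fin n → ℕ) → sumFin f ≡ sum f
sumFin≡sum {zero}  f = refl
sumFin≡sum {suc n} f = cong (f zero +_) (sumFin≡sum (λ i → f (suc i)))

sumFin-cong : ∀ {n} {f g : Fin n → ℕ} → (∀ i → f i ≡ g i) → sumFin f ≡ sumFin g
sumFin-cong {zero}  e = refl
sumFin-cong {suc n} e = cong₂ _+_ (e zero) (sumFin-cong (λ i → e (suc i)))

sumFin-mono : ∀ {n} {f g : Fin n → ℕ} → (∀ i → f i ≤ g i) → sumFin f ≤ sumFin g
sumFin-mono {zero}  e = z≤n
sumFin-mono {suc n} e = +-mono-≤ (e zero) (sumFin-mono (λ i → e (suc i)))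

sumFin-strictMono : ∀ {n} {f g : Fin n → ℕ} → (∀ i → f i ≤ g i) → ∀ j → f j < g j →
                    sumFin f < sumFin g
sumFin-strictMono e zero    lt = +-mono-<-≤ lt (sumFin-mono (λ i → e (suc i)))
sumFin-strictMono e (suc j) lt = +-mono-≤-< (e zero) (sumFin-strictMono (λ i → e (suc i)) j lt)

sumFin-+ : ∀ {n} (f g : Fin n → ℕ) → sumFin (λ i → f i + g i) ≡ sumFin f + sumFin g
sumFin-+ f g = begin
  sumFin (λ i → f i + g i)  ≡⟨ sumFin≡sum (λ i → f i + g i) ⟩
  sum (λ i → f i + g i)     ≡⟨ ∑-distrib-+ f g ⟩
  sum f + sum g             ≡⟨ sym (cong₂ _+_ (sumFin≡sum f) (sumFin≡sum g)) ⟩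
  sumFin f + sumFin g       ∎
  where open ≡-Reasoning

sumFin-*ˡ : ∀ {n} c (f : Fin n → ℕ) → sumFin (λ i → c * f i) ≡ c * sumFin f
sumFin-*ˡ c f = begin
  sumFin (λ i → c * f i)  ≡⟨ sumFin≡sum (λ i → c * f i) ⟩
  sum (λ i → c * f i)     ≡⟨ sym (*-distribˡ-sum c f) ⟩
  c * sum f               ≡⟨ sym (cong (c *_) (sumFin≡sum f)) ⟩
  c * sumFin f            ∎
  where open ≡-Reasoning

sumFin-*ʳ : ∀ {n} (f : Fin n → ℕ) c → sumFin (λ i → f i * c) ≡ sumFin f * c
sumFin-*ʳ f c = begin
  sumFin (λ i → f i * c)  ≡⟨ sumFin≡sum (λ i → f i * c) ⟩
  sum (λ i → f i * c)     ≡⟨ sym (*-distribʳ-sum c f) ⟩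
  sum f * c               ≡⟨ sym (cong (_* c) (sumFin≡sum f)) ⟩
  sumFin f * c            ∎
  where open ≡-Reasoning

sumFin-comm : ∀ {m n} (f : Fin m → Fin n → ℕ) →
              sumFin (λ i → sumFin (f i)) ≡ sumFin (λ j → sumFin (λ i → f i j))
sumFin-comm f = begin
  sumFin (λ i → sumFin (f i))           ≡⟨ sumFin≡sum (λ i → sumFin (f i)) ⟩
  sum (λ i → sumFin (f i))              ≡⟨ sum-cong-≗ (λ i → sumFin≡sum (f i)) ⟩
  sum (λ i → sum (f i))                 ≡⟨ ∑-comm f ⟩
  sum (λ j → sum (λ i → f i j))         ≡⟨ sum-cong-≗ (λ j → sym (sumFin≡sum (λ i → f i j))) ⟩
  sum (λ j → sumFin (λ i → f i j))      ≡⟨ sym (sumFin≡sum (λ j → sumFin (λ i → f i j))) ⟩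
  sumFin (λ j → sumFin (λ i → f i j))   ∎
  where open ≡-Reasoning

sumFin-const : ∀ n c → sumFin {n} (λ _ → c) ≡ n * c
sumFin-const zero    c = refl
sumFin-const (suc n) c = cong (c +_) (sumFin-const n c)

sumFin-zero : ∀ {n} {f : Fin n → ℕ} → (∀ i → f i ≡ 0) → sumFin f ≡ 0
sumFin-zero {n} e = trans (sumFin-cong e) (trans (sumFin-const n 0) (*-zeroʳ n))

term≤sumFin : ∀ {n} (f : Fin n → ℕ) i → f i ≤ sumFin f
term≤sumFin f zero    = m≤m+n _ _
term≤sumFin f (suc i) = ≤-trans (term≤sumFin (λ j → f (suc j)) i) (m≤n+m _ (f zero))

sumFin-pos : ∀ {n} (f : Fin n → ℕ) → 0 < sumFin f → ∃[ i ] 0 < f i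
sumFin-pos {suc n} f pos with f zero in eq
... | suc _ = zero , subst (0 <_) (sym eq) (s≤s z≤n)
... | zero  = let (i , p) = sumFin-pos (λ j → f (suc j)) pos in suc i , p

countFin-mono : ∀ {n} {P Q : Fin n → Bool} → (∀ i → P i ≡ true → Q i ≡ true) →
                countFin P ≤ countFin Q
countFin-mono {P = P} {Q} P⇒Q = sumFin-mono pointwise
  where
  pointwise : ∀ i → 𝟙 (P i) ≤ 𝟙 (Q i)
  pointwise i with P i in e
  ... | false = z≤n
  ... | true  rewrite P⇒Q i e = ≤-refl

countFin-pos : ∀ {n} (P : Fin n → Bool) → 0 < countFin P → ∃[ i ] P i ≡ true
countFin-pos P pos with sumFin-pos (λ i → 𝟙 (P i)) pos
... | i , p with P i in e
...   | true = i , e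

1≤countFin : ∀ {n} (P : Fin n → Bool) i → P i ≡ true → 1 ≤ countFin P
1≤countFin P i e = ≤-trans (≤-reflexive (cong 𝟙 (sym e))) (term≤sumFin (λ j → 𝟙 (P j)) i)

countFin-false : ∀ {n} (P : Fin n → Bool) → (∀ i → P i ≡ false) → countFin P ≡ 0
countFin-false P h = sumFin-zero (λ i → cong 𝟙 (h i))

countFin-true : ∀ n → countFin {n} (λ _ → true) ≡ n
countFin-true n = trans (sumFin-const n 1) (*-identityʳ n)

countFin≤1 : ∀ {n} (P : Fin n → Bool) → (∀ i j → P i ≡ true → P j ≡ true → i ≡ j) →
             countFin P ≤ 1
countFin≤1 {zero}  P uniq = z≤n
countFin≤1 {suc n} P uniq with P zero in e
... | true  = ≤-reflexive (cong suc (countFin-false (λ i → P (suc i)) rest))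
  where
  rest : ∀ i → P (suc i) ≡ false
  rest i with P (suc i) in e′
  ... | false = refl
  ... | true  = contradiction (uniq zero (suc i) e e′) λ ()
... | false = countFin≤1 (λ i → P (suc i)) (λ i j p q → suc-injective (uniq (suc i) (suc j) p q))

countFin≤-ofSubsingleton : ∀ {m n} (P : Fin m → Bool) (Q : Fin n → Bool) → countFin P ≤ 1 →
                           (∀ i → P i ≡ true → ∃[ j ] Q j ≡ true) → countFin P ≤ countFin Q
countFin≤-ofSubsingleton P Q P≤1 witness with countFin P in e
... | zero = z≤n
... | suc zero =
  let (i , Pi) = countFin-pos P (subst (0 <_) (sym e) (s≤s z≤n))
      (j , Qj) = witness i Pi
  in 1≤countFin Q j Qj
countFin≤-ofSubsingleton P Q (s≤s ()) witness | suc (suc _)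

sumFin-splitAt : ∀ m {n} (f : Fin (m + n) → ℕ) →
                 sumFin f ≡ sumFin (λ i → f (i ↑ˡ n)) + sumFin (λ j → f (m ↑ʳ j))
sumFin-splitAt zero    f = refl
sumFin-splitAt (suc m) f =
  trans (cong (f zero +_) (sumFin-splitAt m (λ i → f (suc i)))) (sym (+-assoc (f zero) _ _))

sumFin-empty : ∀ {n} (f : Fin n → ℕ) → n ≡ 0 → sumFin f ≡ 0
sumFin-empty {zero} f _ = refl

sumFin-δ : ∀ {n} (a : Fin n) (g : Fin n → ℕ) → sumFin (λ v → if ⌊ a ≟ v ⌋ then g v else 0) ≡ g a
sumFin-δ {suc n} zero    g = trans (cong (g zero +_) (sumFin-zero {n} (λ _ → refl))) (+-identityʳ _)
sumFin-δ {suc n} (suc a) g =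
  trans (sumFin-cong (λ v → cong (λ t → if t then g (suc v) else 0) (≟-suc v)))
        (sumFin-δ a (λ v → g (suc v)))
  where
  ≟-suc : ∀ v → ⌊ suc a ≟ suc v ⌋ ≡ ⌊ a ≟ v ⌋
  ≟-suc v with a ≟ v
  ... | yes _ = refl
  ... | no  _ = refl

𝟙-∧ : ∀ a b → 𝟙 (a ∧ b) ≡ (if a then 𝟙 b else 0)
𝟙-∧ true  b = refl
𝟙-∧ false b = refl

sumFin-δ² : ∀ {n} (a c : Fin n) (h : Fin n → Fin n → Bool) →
            sumFin (λ v → sumFin (λ u → 𝟙 (⌊ a ≟ v ⌋ ∧ (⌊ c ≟ u ⌋ ∧ h v u)))) ≡ 𝟙 (h a c)
sumFin-δ² {n} a c h = begin
  sumFin (λ v → sumFin (λ u → 𝟙 (⌊ a ≟ v ⌋ ∧ (⌊ c ≟ u ⌋ ∧ h v u))))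
    ≡⟨ sumFin-cong (λ v → trans (sumFin-cong (λ u → 𝟙-∧ ⌊ a ≟ v ⌋ (⌊ c ≟ u ⌋ ∧ h v u)))
                                  (sumFin-if ⌊ a ≟ v ⌋ (λ u → 𝟙 (⌊ c ≟ u ⌋ ∧ h v u)))) ⟩
  sumFin (λ v → if ⌊ a ≟ v ⌋ then sumFin (λ u → 𝟙 (⌊ c ≟ u ⌋ ∧ h v u)) else 0)
    ≡⟨ sumFin-δ a (λ v → sumFin (λ u → 𝟙 (⌊ c ≟ u ⌋ ∧ h v u))) ⟩
  sumFin (λ u → 𝟙 (⌊ c ≟ u ⌋ ∧ h a u))
    ≡⟨ trans (sumFin-cong (λ u → 𝟙-∧ ⌊ c ≟ u ⌋ (h a u))) (sumFin-δ c (λ u → 𝟙 (h a u))) ⟩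
  𝟙 (h a c) ∎
  where
  open ≡-Reasoning
  sumFin-if : ∀ t (g : Fin n → ℕ) → sumFin (λ u → if t then g u else 0) ≡ (if t then sumFin g else 0)
  sumFin-if true  g = refl
  sumFin-if false g = sumFin-zero {n} (λ _ → refl)

sumFin-comm₂₂ : ∀ {a b c d} (f : Fin a → Fin b → Fin c → Fin d → ℕ) →
  sumFin (λ i → sumFin (λ j → sumFin (λ k → sumFin (λ l → f i j k l))))
  ≡ sumFin (λ k → sumFin (λ l → sumFin (λ i → sumFin (λ j → f i j k l))))
sumFin-comm₂₂ f =
  trans (sumFin-cong (λ i → sumFin-comm (λ j k → sumFin (λ l → f i j k l))))
  (trans (sumFin-comm (λ i k → sumFin (λ j → sumFin (λ l → f i j k l))))
  (sumFin-cong (λ k → trans (sumFin-cong (λ i → sumFin-comm (λ j l → f i j k l)))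
                             (sumFin-comm (λ i l → sumFin (λ j → f i j k l))))))

sumList : ∀ {A : Set} → List A → (A → ℕ) → ℕ
sumList []       f = 0
sumList (x ∷ xs) f = f x + sumList xs f

sumList-cong : ∀ {A : Set} (xs : List A) {f g : A → ℕ} → (∀ a → f a ≡ g a) → sumList xs f ≡ sumList xs g
sumList-cong []       e = refl
sumList-cong (x ∷ xs) e = cong₂ _+_ (e x) (sumList-cong xs e)

sumList-mono : ∀ {A : Set} (xs : List A) {f g : A → ℕ} → (∀ a → f a ≤ g a) → sumList xs f ≤ sumList xs g
sumList-mono []       e = z≤n
sumList-mono (x ∷ xs) e = +-mono-≤ (e x) (sumList-mono xs e)

sumList-*ˡ : ∀ {A : Set} (xs : List A) c (f : A → ℕ) → sumList xs (λ a → c * f a) ≡ c * sumList xs f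
sumList-*ˡ []       c f = sym (*-zeroʳ c)
sumList-*ˡ (x ∷ xs) c f = trans (cong (c * f x +_) (sumList-*ˡ xs c f)) (sym (*-distribˡ-+ c (f x) _))

sumFin-sumList : ∀ {A : Set} {n} (xs : List A) (f : Fin n → A → ℕ) →
                 sumFin (λ i → sumList xs (f i)) ≡ sumList xs (λ a → sumFin (λ i → f i a))
sumFin-sumList {n = n} []       f = sumFin-zero {n} (λ i → refl)
sumFin-sumList         (x ∷ xs) f =
  trans (sumFin-+ (λ i → f i x) (λ i → sumList xs (f i))) (cong (_ +_) (sumFin-sumList xs f))

1≤sumList : ∀ {A : Set} (xs : List A) (f : A → ℕ) → Any (λ a → 1 ≤ f a) xs → 1 ≤ sumList xs f
1≤sumList (x ∷ xs) f (here p)  = ≤-trans p (m≤m+n _ _)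
1≤sumList (x ∷ xs) f (there p) = ≤-trans (1≤sumList xs f p) (m≤n+m _ _)

length-cartesianProduct : ∀ {A B : Set} (xs : List A) (ys : List B) →
                          length (cartesianProduct xs ys) ≡ length xs * length ys
length-cartesianProduct []       ys = refl
length-cartesianProduct (x ∷ xs) ys = begin
  length (map (x ,_) ys ++ cartesianProduct xs ys)
    ≡⟨ length-++ (map (x ,_) ys) ⟩
  length (map (x ,_) ys) + length (cartesianProduct xs ys)
    ≡⟨ cong₂ _+_ (length-map (x ,_) ys) (length-cartesianProduct xs ys) ⟩
  length ys + length xs * length ys ∎
  where open ≡-Reasoning

select-cons : ∀ {n m} (b : Bool) → (Fin m → Fin n) → Fin (𝟙 b + m) → Fin (suc n)
select-cons true  r zero    = zero
select-cons true  r (suc i) = suc (r i)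
select-cons false r i       = suc (r i)

select : ∀ {n} (S : Fin n → Bool) → Fin (countFin S) → Fin n
select {suc n} S = select-cons (S zero) (select (λ i → S (suc i)))

select-∈ : ∀ {n} (S : Fin n → Bool) i → S (select S i) ≡ true
select-∈ {suc n} S = go (S zero) refl
  where
  go : ∀ b → S zero ≡ b → ∀ i → S (select-cons b (select (λ j → S (suc j))) i) ≡ true
  go true  e zero    = e
  go true  e (suc i) = select-∈ (λ j → S (suc j)) i
  go false e i       = select-∈ (λ j → S (suc j)) i

select-injective : ∀ {n} (S : Fin n → Bool) → Injective _≡_ _≡_ (select S)
select-injective {suc n} S = go (S zero) (select-injective (λ i → S (suc i)))
  where
  go : ∀ {m} b {r : Fin m → Fin n} → Injective _≡_ _≡_ r → Injective _≡_ _≡_ (select-cons b r)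
  go true  r-inj {zero}  {zero}  e = refl
  go true  r-inj {suc i} {suc j} e = cong suc (r-inj (suc-injective e))
  go false r-inj e                 = r-inj (suc-injective e)

select-surjective : ∀ {n} (S : Fin n → Bool) x → S x ≡ true → ∃[ i ] select S i ≡ x
select-surjective {suc n} S = go (S zero) refl
  where
  go : ∀ b → S zero ≡ b → ∀ x → S x ≡ true →
       ∃[ i ] select-cons b (select (λ j → S (suc j))) i ≡ x
  go true  e zero    Sx = zero , refl
  go false e zero    Sx = contradiction (trans (sym e) Sx) λ ()
  go true  e (suc x) Sx = let (i , q) = select-surjective (λ j → S (suc j)) x Sx in suc i , cong suc q
  go false e (suc x) Sx = let (i , q) = select-surjective (λ j → S (suc j)) x Sx in i , cong suc q

sumFin-select : ∀ {n} (S : Fin n → Bool) (g : Fin n → ℕ) →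
                sumFin (λ i → g (select S i)) ≡ sumFin (λ x → if S x then g x else 0)
sumFin-select {zero}  S g = refl
sumFin-select {suc n} S g with S zero
... | true  = cong (g zero +_) (sumFin-select (λ i → S (suc i)) (λ x → g (suc x)))
... | false = sumFin-select (λ i → S (suc i)) (λ x → g (suc x))

induced : (G : Graph) → (Fin (size G) → Bool) → Graph
induced G S = record
  { size   = countFin S
  ; adj    = λ i j → adj G (select S i) (select S j)
  ; sym    = λ i j → Graph.sym G (select S i) (select S j)
  ; irrefl = λ i → irrefl G (select S i)
  }

induced-isInduced : ∀ G S → InducedSubgraphOf (induced G S) G
induced-isInduced G S = select S , select-injective S , λ _ _ → refl

induced-isSubgraph : ∀ G S → SubgraphOf (induced G S) G
induced-isSubgraph G S = select S , select-injective S , λ _ _ e → e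

<ᵇ-true : ∀ {m n} → m < n → (m <ᵇ n) ≡ true
<ᵇ-true {m} {n} m<n with m <ᵇ n | <⇒<ᵇ m<n
... | true | _ = refl

<ᵇ-false : ∀ {m n} → ¬ m < n → (m <ᵇ n) ≡ false
<ᵇ-false {m} {n} m≮n with m <ᵇ n in e
... | false = refl
... | true  = contradiction (<ᵇ⇒< m n (subst T (sym e) _)) m≮n

degreeSum≡2*numEdges : ∀ G → sumFin (λ i → countFin (adj G i)) ≡ 2 * numEdges G
degreeSum≡2*numEdges G = begin
  sumFin (λ i → sumFin (λ j → 𝟙 (adj G i j)))
    ≡⟨ sumFin-cong (λ i → sumFin-cong (split i)) ⟩
  sumFin (λ i → sumFin (λ j → below i j + above i j))
    ≡⟨ sumFin-cong (λ i → sumFin-+ (below i) (above i)) ⟩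
  sumFin (λ i → sumFin (below i) + sumFin (above i))
    ≡⟨ sumFin-+ (λ i → sumFin (below i)) (λ i → sumFin (above i)) ⟩
  numEdges G + sumFin (λ i → sumFin (above i))
    ≡⟨ cong (numEdges G +_) above≡below ⟩
  numEdges G + numEdges G
    ≡⟨ cong (numEdges G +_) (sym (+-identityʳ _)) ⟩
  2 * numEdges G ∎
  where
  open ≡-Reasoning
  below above : Fin (size G) → Fin (size G) → ℕ
  below i j = 𝟙 ((toℕ j <ᵇ toℕ i) ∧ adj G i j)
  above i j = 𝟙 ((toℕ i <ᵇ toℕ j) ∧ adj G i j)
  above≡below : sumFin (λ i → sumFin (above i)) ≡ numEdges G
  above≡below = trans (sumFin-comm above)
    (sumFin-cong λ j → sumFin-cong λ i → cong (λ b → 𝟙 ((toℕ i <ᵇ toℕ j) ∧ b)) (Graph.sym G i j))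
  split : ∀ i j → 𝟙 (adj G i j) ≡ below i j + above i j
  split i j with adj G i j in e
  ... | false rewrite ∧-zeroʳ (toℕ j <ᵇ toℕ i) | ∧-zeroʳ (toℕ i <ᵇ toℕ j) = refl
  ... | true  rewrite ∧-identityʳ (toℕ j <ᵇ toℕ i) | ∧-identityʳ (toℕ i <ᵇ toℕ j)
    with <-cmp (toℕ i) (toℕ j)
  ...   | tri< i<j _ i≯j rewrite <ᵇ-true i<j | <ᵇ-false i≯j = refl
  ...   | tri> i≮j _ i>j rewrite <ᵇ-true i>j | <ᵇ-false i≮j = refl
  ...   | tri≈ _ i≡j _ with toℕ-injective i≡j
  ...     | refl = contradiction (trans (sym e) (irrefl G i)) λ ()

innerDegreeSum : (G : Graph) → (Fin (size G) → Bool) → ℕ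
innerDegreeSum G S = sumFin λ x → sumFin λ y → 𝟙 ((S x ∧ S y) ∧ adj G x y)

degreeSum-induced : ∀ G S → sumFin (λ i → countFin (adj (induced G S) i)) ≡ innerDegreeSum G S
degreeSum-induced G S =
  trans (sumFin-select S (λ x → countFin (λ j → adj G x (select S j)))) (sumFin-cong row)
  where
  row : ∀ x → (if S x then countFin (λ j → adj G x (select S j)) else 0)
              ≡ sumFin (λ y → 𝟙 ((S x ∧ S y) ∧ adj G x y))
  row x with S x
  ... | true  = trans (sumFin-select S (λ y → 𝟙 (adj G x y))) (sumFin-cong (λ y → if-𝟙 (S y) y))
    where
    if-𝟙 : ∀ b y → (if b then 𝟙 (adj G x y) else 0) ≡ 𝟙 (b ∧ adj G x y)
    if-𝟙 true  y = refl
    if-𝟙 false y = refl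
  ... | false = sym (sumFin-zero {size G} (λ y → refl))

2*numEdges≤mad : ∀ {G D} → MadAtMost G D → ∀ G′ → SubgraphOf G′ G → 2 * numEdges G′ ≤ D * size G′
2*numEdges≤mad mad G′ G′⊆G with 0 <? size G′
... | yes nonempty = mad G′ G′⊆G nonempty
... | no  empty    =
  ≤-trans (≤-reflexive (cong (2 *_) (sumFin-empty _ (n≤0⇒n≡0 (≮⇒≥ empty))))) z≤n

innerDegreeSum≤mad : ∀ {G D} → MadAtMost G D → ∀ S → innerDegreeSum G S ≤ D * countFin S
innerDegreeSum≤mad {G} {D} mad S = begin
  innerDegreeSum G S
    ≡⟨ sym (degreeSum-induced G S) ⟩
  sumFin (λ i → countFin (adj (induced G S) i))
    ≡⟨ degreeSum≡2*numEdges (induced G S) ⟩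
  2 * numEdges (induced G S)
    ≤⟨ 2*numEdges≤mad {G} {D} mad (induced G S) (induced-isSubgraph G S) ⟩
  D * countFin S ∎
  where open ≤-Reasoning

degreeIn : (H : Graph) → (Fin (size H) → Bool) → Fin (size H) → ℕ
degreeIn H X v = countFin (λ u → X u ∧ adj H v u)

innerDegreeSum≡sumFin-degreeIn : ∀ H (X : Fin (size H) → Bool) →
                                 innerDegreeSum H X ≡ sumFin (λ v → if X v then degreeIn H X v else 0)
innerDegreeSum≡sumFin-degreeIn H X = sumFin-cong row
  where
  row : ∀ v → sumFin (λ u → 𝟙 ((X v ∧ X u) ∧ adj H v u)) ≡ (if X v then degreeIn H X v else 0)
  row v with X v
  ... | true  = refl
  ... | false = sumFin-zero {size H} (λ _ → refl)

Covers : ∀ {𝒢 H} → Piece 𝒢 H → Fin (size H) → Fin (size H) → Set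
Covers p u v = ∃[ x ] ∃[ y ] (adj (G p) x y ≡ true × φ p x ≡ u × φ p y ≡ v)

InjectivePiece : ∀ {𝒢 H} → Piece 𝒢 H → Set
InjectivePiece p = Injective _≡_ _≡_ (φ p)

fibreSize : ∀ {𝒢 H} → Piece 𝒢 H → Fin (size H) → ℕ
fibreSize p v = countFin (λ x → ⌊ φ p x ≟ v ⌋)

preimageSize≡sumList : ∀ {𝒢 H} (ps : List (Piece 𝒢 H)) v →
                       preimageSize ps v ≡ sumList ps (λ p → fibreSize p v)
preimageSize≡sumList []       v = refl
preimageSize≡sumList (p ∷ ps) v = cong (fibreSize p v +_) (preimageSize≡sumList ps v)

preimageSize-++ : ∀ {𝒢 H} (ps qs : List (Piece 𝒢 H)) v →
                  preimageSize (ps ++ qs) v ≡ preimageSize ps v + preimageSize qs v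
preimageSize-++ []       qs v = refl
preimageSize-++ (p ∷ ps) qs v =
  trans (cong (fibreSize p v +_) (preimageSize-++ ps qs v)) (sym (+-assoc (fibreSize p v) _ _))

fibreSize≤1 : ∀ {𝒢 H} (p : Piece 𝒢 H) → InjectivePiece p → ∀ v → fibreSize p v ≤ 1
fibreSize≤1 p φ-inj v =
  countFin≤1 _ (λ x y ex ey → φ-inj (trans (⌊⌋⇒ (φ p x ≟ v) ex) (sym (⌊⌋⇒ (φ p y ≟ v) ey))))

injLocal⇒local : ∀ {𝒢 H s} → HasInjLocalCover 𝒢 H s → HasLocalCover 𝒢 H s
injLocal⇒local (C , _ , local) = C , local

refineCover : ∀ {𝒢 H s} N (C : Cover 𝒢 H) → IsLocal C s → (R : Piece 𝒢 H → List (Piece 𝒢 H)) →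
  (∀ p → All InjectivePiece (R p)) →
  (∀ p → (∀ w → fibreSize p w ≤ s) → ∀ u v → adj H u v ≡ true → Covers p u v →
         Any (λ q → Covers q u v) (R p)) →
  (∀ p v → preimageSize (R p) v ≤ N * fibreSize p v) →
  HasInjLocalCover 𝒢 H (N * s)
refineCover {𝒢} {H} {s} N C local R R-inj R-covers R-local =
  record { pieces = concatMap R (pieces C) ; surj = λ u v uv → covers (pieces C) local u v uv (surj C u v uv) }
  , Allₚ.concat⁺ (Allₚ.map⁺ (universal R-inj (pieces C)))
  , λ v → ≤-trans (preimage-concatMap (pieces C) v) (*-monoʳ-≤ N (local v))
  where
  covers : ∀ ps → (∀ w → preimageSize ps w ≤ s) → ∀ u v → adj H u v ≡ true →
           Any (λ p → Covers p u v) ps → Any (λ q → Covers q u v) (concatMap R ps)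
  covers (p ∷ ps) bound u v uv (here c)  =
    Anyₚ.++⁺ˡ (R-covers p (λ w → ≤-trans (m≤m+n _ _) (bound w)) u v uv c)
  covers (p ∷ ps) bound u v uv (there c) =
    Anyₚ.++⁺ʳ (R p) (covers ps (λ w → ≤-trans (m≤n+m _ _) (bound w)) u v uv c)
  preimage-concatMap : ∀ ps v → preimageSize (concatMap R ps) v ≤ N * preimageSize ps v
  preimage-concatMap []       v = z≤n
  preimage-concatMap (p ∷ ps) v = begin
    preimageSize (R p ++ concatMap R ps) v
      ≡⟨ preimageSize-++ (R p) (concatMap R ps) v ⟩
    preimageSize (R p) v + preimageSize (concatMap R ps) v
      ≤⟨ +-mono-≤ (R-local p v) (preimage-concatMap ps v) ⟩
    N * fibreSize p v + N * preimageSize ps v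
      ≡⟨ sym (*-distribˡ-+ N (fibreSize p v) _) ⟩
    N * preimageSize (p ∷ ps) v ∎
    where open ≤-Reasoning

covers? : ∀ {𝒢 H} (p : Piece 𝒢 H) u v → Dec (Covers p u v)
covers? p u v = any? λ x → any? λ y → (adj (G p) x y ≟ᵇ true) ×-dec (φ p x ≟ u) ×-dec (φ p y ≟ v)

-- From a proper colouring to an injective cover

module Slicing {𝒢 : Class} (hereditary : Hereditary 𝒢) {H : Graph} {k : ℕ}
                (col : Fin (size H) → Fin k) (b : ℕ) where

  rank : (p : Piece 𝒢 H) → Fin (size (G p)) → ℕ
  rank p x = countFin (λ y → (toℕ y <ᵇ toℕ x) ∧ ⌊ φ p y ≟ φ p x ⌋)

  rank<fibreSize : ∀ p x → rank p x < fibreSize p (φ p x)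
  rank<fibreSize p x = sumFin-strictMono (λ y → 𝟙-∧≤ʳ (toℕ y <ᵇ toℕ x) _) x x-counted
    where
    x-counted : 𝟙 ((toℕ x <ᵇ toℕ x) ∧ ⌊ φ p x ≟ φ p x ⌋) < 𝟙 ⌊ φ p x ≟ φ p x ⌋
    x-counted rewrite <ᵇ-false (<-irrefl {toℕ x} refl) | ⌊⌋-true (φ p x ≟ φ p x) refl = s≤s z≤n

  rank-strictMono : ∀ p x y → φ p x ≡ φ p y → toℕ x < toℕ y → rank p x < rank p y
  rank-strictMono p x y φx≡φy x<y = sumFin-strictMono pointwise x x-counted
    where
    pointwise : ∀ z → 𝟙 ((toℕ z <ᵇ toℕ x) ∧ ⌊ φ p z ≟ φ p x ⌋)
                    ≤ 𝟙 ((toℕ z <ᵇ toℕ y) ∧ ⌊ φ p z ≟ φ p y ⌋)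
    pointwise z with toℕ z <ᵇ toℕ x in z<x
    ... | false = z≤n
    ... | true rewrite <ᵇ-true (<-trans (<ᵇ⇒< (toℕ z) (toℕ x) (subst T (sym z<x) _)) x<y) | φx≡φy = ≤-refl
    x-counted : 𝟙 ((toℕ x <ᵇ toℕ x) ∧ ⌊ φ p x ≟ φ p x ⌋)
              < 𝟙 ((toℕ x <ᵇ toℕ y) ∧ ⌊ φ p x ≟ φ p y ⌋)
    x-counted rewrite <ᵇ-false (<-irrefl {toℕ x} refl) | <ᵇ-true x<y | φx≡φy
                    | ⌊⌋-true (φ p y ≟ φ p y) refl = s≤s z≤n

  rank-injective : ∀ p x y → φ p x ≡ φ p y → rank p x ≡ rank p y → x ≡ y
  rank-injective p x y φx≡φy rx≡ry with <-cmp (toℕ x) (toℕ y)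
  ... | tri< x<y _ _ = contradiction rx≡ry (<⇒≢ (rank-strictMono p x y φx≡φy x<y))
  ... | tri≈ _ x≡y _ = toℕ-injective x≡y
  ... | tri> _ _ y<x = contradiction (sym rx≡ry) (<⇒≢ (rank-strictMono p y x (sym φx≡φy) y<x))

  Index : Set
  Index = Fin b × Fin k × Fin b

  target : Index → Fin (size H) → ℕ
  target (i , c , j) w = if ⌊ col w ≟ c ⌋ then toℕ j else toℕ i

  target-colour : ∀ i c j w → col w ≡ c → target (i , c , j) w ≡ toℕ j
  target-colour i c j w e rewrite ⌊⌋-true (col w ≟ c) e = refl

  target-otherColour : ∀ i c j w → ¬ col w ≡ c → target (i , c , j) w ≡ toℕ i
  target-otherColour i c j w ne rewrite ⌊⌋-false (col w ≟ c) ne = refl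

  onTarget : (p : Piece 𝒢 H) → Index → Fin (size (G p)) → Bool
  onTarget p τ x = ⌊ rank p x ≟ℕ target τ (φ p x) ⌋

  slice : Piece 𝒢 H → Index → Piece 𝒢 H
  slice p τ = record
    { G   = induced (G p) (onTarget p τ)
    ; mem = hereditary (G p) _ (mem p) (induced-isInduced (G p) (onTarget p τ))
    ; φ   = λ a → φ p (select (onTarget p τ) a)
    ; hom = λ a a′ → hom p (select (onTarget p τ) a) (select (onTarget p τ) a′)
    }

  slice-injective : ∀ p τ → InjectivePiece (slice p τ)
  slice-injective p τ {a} {a′} φa≡φa′ =
    select-injective (onTarget p τ) (rank-injective p _ _ φa≡φa′ (begin
      rank p (select S a)            ≡⟨ ⌊⌋⇒ (_ ≟ℕ _) (select-∈ S a) ⟩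
      target τ (φ (slice p τ) a)     ≡⟨ cong (target τ) φa≡φa′ ⟩
      target τ (φ (slice p τ) a′)    ≡⟨ sym (⌊⌋⇒ (_ ≟ℕ _) (select-∈ S a′)) ⟩
      rank p (select S a′)           ∎))
    where
    open ≡-Reasoning
    S = onTarget p τ

  fibreSize-slice : ∀ p τ v → fibreSize (slice p τ) v ≤ fibreSize p v
  fibreSize-slice p τ v = countFin≤-ofSubsingleton _ _ (fibreSize≤1 (slice p τ) (slice-injective p τ) v)
                                          (λ a e → select (onTarget p τ) a , e)

  slice-covers : ∀ p → (∀ w → fibreSize p w ≤ b) → ∀ u v → ¬ col u ≡ col v → Covers p u v →
                 ∃[ τ ] Covers (slice p τ) u v
  slice-covers p small u v col-u≢col-v (x , y , xy , φx≡u , φy≡v) =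
    τ , x′ , y′ , subst₂ (λ s t → adj (G p) s t ≡ true) (sym x′≡x) (sym y′≡y) xy
      , trans (cong (φ p) x′≡x) φx≡u , trans (cong (φ p) y′≡y) φy≡v
    where
    rank<b : ∀ z → rank p z < b
    rank<b z = <-≤-trans (rank<fibreSize p z) (small (φ p z))
    τ : Index
    τ = fromℕ< (rank<b x) , col v , fromℕ< (rank<b y)
    x-on : onTarget p τ x ≡ true
    x-on = ⌊⌋-true (_ ≟ℕ _) (sym (trans
      (target-otherColour _ _ _ (φ p x) (subst (λ w → ¬ col w ≡ col v) (sym φx≡u) col-u≢col-v))
      (toℕ-fromℕ< (rank<b x))))
    y-on : onTarget p τ y ≡ true
    y-on = ⌊⌋-true (_ ≟ℕ _) (sym (trans
      (target-colour _ _ _ (φ p y) (cong col φy≡v))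
      (toℕ-fromℕ< (rank<b y))))
    x′ = proj₁ (select-surjective (onTarget p τ) x x-on)
    x′≡x = proj₂ (select-surjective (onTarget p τ) x x-on)
    y′ = proj₁ (select-surjective (onTarget p τ) y y-on)
    y′≡y = proj₂ (select-surjective (onTarget p τ) y y-on)

  indices : List Index
  indices = cartesianProduct (allFin b) (cartesianProduct (allFin k) (allFin b))

  length-indices : length indices ≡ b * (k * b)
  length-indices = begin
    length indices
      ≡⟨ length-cartesianProduct (allFin b) _ ⟩
    length (allFin b) * length (cartesianProduct (allFin k) (allFin b))
      ≡⟨ cong (length (allFin b) *_) (length-cartesianProduct (allFin k) (allFin b)) ⟩
    length (allFin b) * (length (allFin k) * length (allFin b))
      ≡⟨ cong₂ (λ l m → l * (m * l)) (length-allFin b) (length-allFin k) ⟩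
    b * (k * b) ∎
    where
    open ≡-Reasoning
    length-allFin : ∀ m → length (allFin m) ≡ m
    length-allFin m = length-tabulate id

  ∈-indices : ∀ τ → τ ∈ indices
  ∈-indices (i , c , j) = ∈-cartesianProduct⁺ (∈-allFin i) (∈-cartesianProduct⁺ (∈-allFin c) (∈-allFin j))

  slices : Piece 𝒢 H → List (Piece 𝒢 H)
  slices p = map (slice p) indices

  slices-injective : ∀ p → All InjectivePiece (slices p)
  slices-injective p = Allₚ.map⁺ (universal (slice-injective p) indices)

  preimageSize-slices : ∀ p v → preimageSize (slices p) v ≤ b * (k * b) * fibreSize p v
  preimageSize-slices p v = subst (λ n → preimageSize (slices p) v ≤ n * fibreSize p v) length-indices
                                  (go indices)
    where
    go : ∀ τs → preimageSize (map (slice p) τs) v ≤ length τs * fibreSize p v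
    go []       = z≤n
    go (τ ∷ τs) = +-mono-≤ (fibreSize-slice p τ v) (go τs)

  slices-cover : ∀ p → (∀ w → fibreSize p w ≤ b) → ∀ u v → ¬ col u ≡ col v → Covers p u v →
                 Any (λ q → Covers q u v) (slices p)
  slices-cover p small u v col-u≢col-v c =
    let (τ , c′) = slice-covers p small u v col-u≢col-v c
    in Anyₚ.gmap (λ { refl → c′ }) (∈-indices τ)

colouring⇒injectiveCover : ∀ {𝒢 H k b} → Hereditary 𝒢 → Colourable H k → HasLocalCover 𝒢 H b →
                           HasInjLocalCover 𝒢 H (b * (k * b) * b)
colouring⇒injectiveCover {k = k} {b} hereditary (col , proper) (C , local) =
  refineCover (b * (k * b)) C local slices slices-injective
    (λ p small u v uv → slices-cover p small u v (proper u v uv))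
    preimageSize-slices
  where open Slicing hereditary col b

-- Degeneracy of graphs with a local cover of bounded mad

countFin-pullback : ∀ {𝒢 H} (p : Piece 𝒢 H) (X : Fin (size H) → Bool) →
                    countFin (λ x → X (φ p x)) ≡ sumFin (λ v → if X v then fibreSize p v else 0)
countFin-pullback p X = begin
  sumFin (λ x → 𝟙 (X (φ p x)))
    ≡⟨ sumFin-cong (λ x → sym (sumFin-δ (φ p x) (λ v → 𝟙 (X v)))) ⟩
  sumFin (λ x → sumFin (λ v → if ⌊ φ p x ≟ v ⌋ then 𝟙 (X v) else 0))
    ≡⟨ sumFin-comm (λ x v → if ⌊ φ p x ≟ v ⌋ then 𝟙 (X v) else 0) ⟩
  sumFin (λ v → sumFin (λ x → if ⌊ φ p x ≟ v ⌋ then 𝟙 (X v) else 0))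
    ≡⟨ sumFin-cong fibre ⟩
  sumFin (λ v → if X v then fibreSize p v else 0) ∎
  where
  open ≡-Reasoning
  fibre : ∀ v → sumFin (λ x → if ⌊ φ p x ≟ v ⌋ then 𝟙 (X v) else 0) ≡ (if X v then fibreSize p v else 0)
  fibre v with X v
  ... | true  = refl
  ... | false = sumFin-zero (λ x → if-0 ⌊ φ p x ≟ v ⌋)
    where
    if-0 : ∀ (t : Bool) → (if t then 0 else 0) ≡ 0
    if-0 true  = refl
    if-0 false = refl

innerDegreeSum-pullback : ∀ {𝒢 H} (C : Cover 𝒢 H) (X : Fin (size H) → Bool) →
  innerDegreeSum H X ≤ sumList (pieces C) (λ p → innerDegreeSum (G p) (λ x → X (φ p x)))
innerDegreeSum-pullback {H = H} C X = begin
  innerDegreeSum H X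
    ≤⟨ sumFin-mono (λ v → sumFin-mono (λ u → edge≤lifts v u)) ⟩
  sumFin (λ v → sumFin (λ u → sumList ps (λ p → lifts p v u)))
    ≡⟨ sumFin-cong (λ v → sumFin-sumList ps (λ u p → lifts p v u)) ⟩
  sumFin (λ v → sumList ps (λ p → sumFin (λ u → lifts p v u)))
    ≡⟨ sumFin-sumList ps (λ v p → sumFin (λ u → lifts p v u)) ⟩
  sumList ps (λ p → sumFin (λ v → sumFin (λ u → lifts p v u)))
    ≡⟨ sumList-cong ps liftsTotal ⟩
  sumList ps (λ p → innerDegreeSum (G p) (λ x → X (φ p x))) ∎
  where
  open ≤-Reasoning
  ps = pieces C
  lift : (p : Piece _ H) → Fin (size H) → Fin (size H) → Fin (size (G p)) → Fin (size (G p)) → ℕ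
  lift p v u x y = 𝟙 (⌊ φ p x ≟ v ⌋ ∧ (⌊ φ p y ≟ u ⌋ ∧ ((X v ∧ X u) ∧ adj (G p) x y)))
  lifts : (p : Piece _ H) → Fin (size H) → Fin (size H) → ℕ
  lifts p v u = sumFin (λ x → sumFin (λ y → lift p v u x y))
  edge≤lifts : ∀ v u → 𝟙 ((X v ∧ X u) ∧ adj H v u) ≤ sumList ps (λ p → lifts p v u)
  edge≤lifts v u with (X v ∧ X u) ∧ adj H v u in e
  ... | false = z≤n
  ... | true  = 1≤sumList ps (λ p → lifts p v u)
                  (Any.map (λ {p} → lifted {p}) (surj C v u (∧-conicalʳ (X v ∧ X u) _ e)))
    where
    lifted : ∀ {p} → Covers p v u → 1 ≤ lifts p v u
    lifted {p} (x , y , xy , φx≡v , φy≡u) =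
      ≤-trans (≤-trans (≤-reflexive (cong 𝟙 (sym counted))) (term≤sumFin (lift p v u x) y))
              (term≤sumFin (λ x → sumFin (lift p v u x)) x)
      where
      counted : (⌊ φ p x ≟ v ⌋ ∧ (⌊ φ p y ≟ u ⌋ ∧ ((X v ∧ X u) ∧ adj (G p) x y))) ≡ true
      counted rewrite ⌊⌋-true (φ p x ≟ v) φx≡v | ⌊⌋-true (φ p y ≟ u) φy≡u | xy =
        trans (∧-identityʳ _) (∧-conicalˡ _ _ e)
  liftsTotal : ∀ p → sumFin (λ v → sumFin (λ u → lifts p v u)) ≡ innerDegreeSum (G p) (λ x → X (φ p x))
  liftsTotal p = trans (sumFin-comm₂₂ (lift p)) (sumFin-cong λ x → sumFin-cong λ y →
                   sumFin-δ² (φ p x) (φ p y) (λ v u → (X v ∧ X u) ∧ adj (G p) x y))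

pullbackSize≤ : ∀ {𝒢 H b} (C : Cover 𝒢 H) → IsLocal C b → ∀ (X : Fin (size H) → Bool) →
                sumList (pieces C) (λ p → countFin (λ x → X (φ p x))) ≤ b * countFin X
pullbackSize≤ {H = H} {b} C local X = begin
  sumList ps (λ p → countFin (λ x → X (φ p x)))
    ≡⟨ sumList-cong ps (λ p → countFin-pullback p X) ⟩
  sumList ps (λ p → sumFin (λ v → if X v then fibreSize p v else 0))
    ≡⟨ sym (sumFin-sumList ps (λ v p → if X v then fibreSize p v else 0)) ⟩
  sumFin (λ v → sumList ps (λ p → if X v then fibreSize p v else 0))
    ≤⟨ sumFin-mono bounded ⟩
  sumFin (λ v → b * 𝟙 (X v))
    ≡⟨ sumFin-*ˡ b (λ v → 𝟙 (X v)) ⟩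
  b * countFin X ∎
  where
  open ≤-Reasoning
  ps = pieces C
  bounded : ∀ v → sumList ps (λ p → if X v then fibreSize p v else 0) ≤ b * 𝟙 (X v)
  bounded v with X v
  ... | true  = ≤-trans (≤-reflexive (sym (preimageSize≡sumList ps v)))
                        (≤-trans (local v) (≤-reflexive (sym (*-identityʳ b))))
  ... | false = ≤-reflexive (trans (sumList-zero ps) (sym (*-zeroʳ b)))
    where
    sumList-zero : ∀ (qs : List (Piece _ H)) → sumList qs (λ _ → 0) ≡ 0
    sumList-zero []       = refl
    sumList-zero (q ∷ qs) = sumList-zero qs

innerDegreeSum≤-ofLocalCover : ∀ {𝒢 H D b} → (∀ G → 𝒢 G → MadAtMost G D) →
                               (C : Cover 𝒢 H) → IsLocal C b →
                               ∀ X → innerDegreeSum H X ≤ D * b * countFin X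
innerDegreeSum≤-ofLocalCover {H = H} {D} {b} mad C local X = begin
  innerDegreeSum H X
    ≤⟨ innerDegreeSum-pullback C X ⟩
  sumList ps (λ p → innerDegreeSum (G p) (λ x → X (φ p x)))
    ≤⟨ sumList-mono ps (λ p → innerDegreeSum≤mad {G p} {D} (mad (G p) (mem p)) (λ x → X (φ p x))) ⟩
  sumList ps (λ p → D * countFin (λ x → X (φ p x)))
    ≡⟨ sumList-*ˡ ps D (λ p → countFin (λ x → X (φ p x))) ⟩
  D * sumList ps (λ p → countFin (λ x → X (φ p x)))
    ≤⟨ *-monoʳ-≤ D (pullbackSize≤ C local X) ⟩
  D * (b * countFin X)
    ≡⟨ sym (*-assoc D b (countFin X)) ⟩
  D * b * countFin X ∎
  where
  open ≤-Reasoning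
  ps = pieces C

lowDegreeVertex : ∀ {H} M → (∀ X → innerDegreeSum H X ≤ M * countFin X) →
                  ∀ X → 0 < countFin X → ∃[ v ] (X v ≡ true × degreeIn H X v ≤ M)
lowDegreeVertex {H} M sparse X nonempty with any? (λ v → (X v ≟ᵇ true) ×-dec (degreeIn H X v ≤? M))
... | yes found = found
... | no  none  = contradiction (≤-trans (+-monoˡ-≤ (M * countFin X) nonempty) dense) (<-irrefl refl)
  where
  high : ∀ v → X v ≡ true → suc M ≤ degreeIn H X v
  high v Xv = ≰⇒> (λ low → none (v , Xv , low))
  pointwise : ∀ v → suc M * 𝟙 (X v) ≤ (if X v then degreeIn H X v else 0)
  pointwise v with X v in Xv
  ... | true  = ≤-trans (≤-reflexive (*-identityʳ (suc M))) (high v Xv)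
  ... | false = ≤-reflexive (*-zeroʳ (suc M))
  dense : suc M * countFin X ≤ M * countFin X
  dense = begin
    suc M * countFin X                                   ≡⟨ sym (sumFin-*ˡ (suc M) (λ v → 𝟙 (X v))) ⟩
    sumFin (λ v → suc M * 𝟙 (X v))                       ≤⟨ sumFin-mono pointwise ⟩
    sumFin (λ v → if X v then degreeIn H X v else 0)     ≡⟨ sym (innerDegreeSum≡sumFin-degreeIn H X) ⟩
    innerDegreeSum H X                                   ≤⟨ sparse X ⟩
    M * countFin X                                       ∎
    where open ≤-Reasoning

-- Greedy colouring

unusedColour : ∀ {n M} (N : Fin n → Bool) (col : Fin n → Fin (suc M)) → countFin N ≤ M →
               ∃[ k ] (∀ u → N u ≡ true → ¬ col u ≡ k)
unusedColour {M = M} N col small with any? (λ k → ¬? (any? (λ u → (N u ≟ᵇ true) ×-dec (col u ≟ k))))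
... | yes (k , unused) = k , λ u Nu colu≡k → unused (u , Nu , colu≡k)
... | no  allUsed      =
  let (i , j , i<j , same) = pigeonhole (s≤s small) index
  in  contradiction (index-injective same) (<⇒≢ᶠ i<j)
  where
  user : ∀ k → ∃[ u ] (N u ≡ true × col u ≡ k)
  user k = decidable-stable (any? (λ u → (N u ≟ᵇ true) ×-dec (col u ≟ k))) (λ unused → allUsed (k , unused))
  index : Fin (suc M) → Fin (countFin N)
  index k = proj₁ (select-surjective N (proj₁ (user k)) (proj₁ (proj₂ (user k))))
  colour∘index : ∀ k → col (select N (index k)) ≡ k
  colour∘index k = trans (cong col (proj₂ (select-surjective N _ (proj₁ (proj₂ (user k))))))
                         (proj₂ (proj₂ (user k)))
  index-injective : ∀ {k l} → index k ≡ index l → k ≡ l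
  index-injective {k} {l} e = trans (sym (colour∘index k)) (trans (cong (col ∘ select N) e) (colour∘index l))

ProperOn : ∀ {k} (H : Graph) → (Fin (size H) → Bool) → (Fin (size H) → Fin k) → Set
ProperOn H X col = ∀ i j → X i ≡ true → X j ≡ true → adj H i j ≡ true → ¬ col i ≡ col j

remove : ∀ {n} → (Fin n → Bool) → Fin n → Fin n → Bool
remove X v u = X u ∧ not ⌊ u ≟ v ⌋

countFin-remove : ∀ {n} (X : Fin n → Bool) v → X v ≡ true → countFin (remove X v) < countFin X
countFin-remove X v Xv = sumFin-strictMono (λ u → 𝟙-∧≤ˡ (X u) _) v v-removed
  where
  v-removed : 𝟙 (X v ∧ not ⌊ v ≟ v ⌋) < 𝟙 (X v)
  v-removed rewrite Xv | ⌊⌋-true (v ≟ v) refl = s≤s z≤n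

remove-∈ : ∀ {n} (X : Fin n → Bool) {v u} → X u ≡ true → ¬ u ≡ v → remove X v u ≡ true
remove-∈ X {v} {u} Xu u≢v rewrite Xu | ⌊⌋-false (u ≟ v) u≢v = refl

degreeIn-remove≤ : ∀ {H} (X : Fin (size H) → Bool) v w → degreeIn H (remove X v) w ≤ degreeIn H X w
degreeIn-remove≤ {H} X v w = countFin-mono kept
  where
  kept : ∀ u → (remove X v u ∧ adj H w u) ≡ true → (X u ∧ adj H w u) ≡ true
  kept u e = subst₂ (λ a b → (a ∧ b) ≡ true)
    (sym (∧-conicalˡ _ _ (∧-conicalˡ _ _ e))) (sym (∧-conicalʳ (remove X v u) _ e)) refl

extendColouring : ∀ {H M} X v (col : Fin (size H) → Fin (suc M)) → ProperOn H (remove X v) col →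
                  degreeIn H (remove X v) v ≤ M → Σ (Fin (size H) → Fin (suc M)) (ProperOn H X)
extendColouring {H} X v col proper small = col′ , proper′
  where
  free = unusedColour (λ u → remove X v u ∧ adj H v u) col small
  col′ : Fin (size H) → _
  col′ u = if ⌊ u ≟ v ⌋ then proj₁ free else col u
  col′-v : col′ v ≡ proj₁ free
  col′-v rewrite ⌊⌋-true (v ≟ v) refl = refl
  col′-other : ∀ {u} → ¬ u ≡ v → col′ u ≡ col u
  col′-other {u} u≢v rewrite ⌊⌋-false (u ≟ v) u≢v = refl
  differs : ∀ u → X u ≡ true → ¬ u ≡ v → adj H v u ≡ true → ¬ col′ u ≡ col′ v
  differs u Xu u≢v vu e =
    proj₂ free u (trans (cong (_∧ adj H v u) (remove-∈ X Xu u≢v)) vu)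
                 (trans (sym (col′-other u≢v)) (trans e col′-v))
  proper′ : ProperOn H X col′
  proper′ i j Xi Xj ij = cases (i ≟ v) (j ≟ v)
    where
    cases : Dec (i ≡ v) → Dec (j ≡ v) → ¬ col′ i ≡ col′ j
    cases (yes refl) (yes refl) = contradiction (trans (sym ij) (irrefl H i)) λ ()
    cases (yes refl) (no j≢v)   = differs j Xj j≢v ij ∘ sym
    cases (no i≢v)   (yes refl) = differs i Xi i≢v (trans (Graph.sym H j i) ij)
    cases (no i≢v)   (no j≢v)   = λ e → proper i j (remove-∈ X Xi i≢v) (remove-∈ X Xj j≢v) ij
                                          (trans (sym (col′-other i≢v)) (trans e (col′-other j≢v)))

degenerate⇒colourable : ∀ {H} M → (∀ X → 0 < countFin X → ∃[ v ] (X v ≡ true × degreeIn H X v ≤ M)) →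
                        Colourable H (suc M)
degenerate⇒colourable {H} M degenerate =
  let (col , proper) = greedy (size H) (λ _ → true) (≤-reflexive (countFin-true (size H)))
  in  col , λ i j → proper i j refl refl
  where
  greedy : ∀ fuel X → countFin X ≤ fuel → Σ (Fin (size H) → Fin (suc M)) (ProperOn H X)
  greedy fuel X bound with countFin X in e
  ... | zero = (λ _ → zero) , λ i _ Xi _ _ _ → contradiction (subst (1 ≤_) e (1≤countFin X i Xi)) λ ()
  greedy (suc fuel) X (s≤s bound) | suc _ =
    let (v , Xv , small) = degenerate X (subst (0 <_) (sym e) (s≤s z≤n))
        fewer = ≤-trans (subst (countFin (remove X v) <_) e (countFin-remove X v Xv)) (s≤s bound)
        (col , proper) = greedy fuel (remove X v) (≤-pred fewer)
    in  extendColouring {H} X v col proper (≤-trans (degreeIn-remove≤ {H} X v v) small)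

lfBounded-ofColourings : ∀ {𝒢 ℋ} → Hereditary 𝒢 → (χ : ℕ → ℕ) →
  (∀ H → ℋ H → ∀ b → HasLocalCover 𝒢 H b → Colourable H (χ b)) → LFBounded 𝒢 ℋ
lfBounded-ofColourings hereditary χ colourable =
  (λ b → b * (χ b * b) * b) , λ H ℋH a b (injCover , a-least) (cover , b-least) →
    b-least a (injLocal⇒local injCover) ,
    a-least _ (colouring⇒injectiveCover hereditary (colourable H ℋH b cover) cover)

lfBounded-ofBoundedMad : ∀ 𝒢 ℋ → Hereditary 𝒢 → BoundedMad 𝒢 → LFBounded 𝒢 ℋ
lfBounded-ofBoundedMad 𝒢 ℋ hereditary (D , mad) =
  lfBounded-ofColourings hereditary (λ b → suc (D * b)) λ H _ b (C , local) →
    degenerate⇒colourable {H} (D * b)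
      (lowDegreeVertex {H} (D * b) (innerDegreeSum≤-ofLocalCover {D = D} mad C local))

lfBounded-ofBoundedChromatic : ∀ 𝒢 ℋ → Hereditary 𝒢 → BoundedChromatic ℋ → LFBounded 𝒢 ℋ
lfBounded-ofBoundedChromatic 𝒢 ℋ hereditary (k , colourable) =
  lfBounded-ofColourings hereditary (λ _ → k) λ H ℋH _ _ → colourable H ℋH

-- Bounded c_f with unbounded c_l

module EdgeCover {𝒢 : Class} (𝒢K2 : 𝒢 K2) (H : Graph) where

  endpoints : Fin (size H) → Fin (size H) → Fin 2 → Fin (size H)
  endpoints u v zero    = u
  endpoints u v (suc _) = v

  edgePiece : ∀ {u v} → adj H u v ≡ true → Piece 𝒢 H
  edgePiece {u} {v} uv = record { G = K2 ; mem = 𝒢K2 ; φ = endpoints u v ; hom = endpoints-hom }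
    where
    endpoints-hom : ∀ x y → adj K2 x y ≡ true → adj H (endpoints u v x) (endpoints u v y) ≡ true
    endpoints-hom zero       (suc zero) _ = uv
    endpoints-hom (suc zero) zero       _ = trans (Graph.sym H v u) uv

  edgePiece-injective : ∀ {u v} (uv : adj H u v ≡ true) → InjectivePiece (edgePiece uv)
  edgePiece-injective uv {zero}     {zero}     _   = refl
  edgePiece-injective uv {suc zero} {suc zero} _   = refl
  edgePiece-injective {u} uv {zero} {suc zero} u≡v =
    contradiction (trans (sym uv) (subst (λ w → adj H u w ≡ false) u≡v (irrefl H u))) λ ()
  edgePiece-injective {v = v} uv {suc zero} {zero} v≡u =
    contradiction (trans (sym uv) (subst (λ w → adj H w v ≡ false) v≡u (irrefl H v))) λ ()

  edgePieceIf : ∀ u v b → adj H u v ≡ b → List (Piece 𝒢 H)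
  edgePieceIf u v true  uv = edgePiece uv ∷ []
  edgePieceIf u v false _  = []

  edgePieceIf-injective : ∀ u v b (e : adj H u v ≡ b) → All InjectivePiece (edgePieceIf u v b e)
  edgePieceIf-injective u v true  uv = edgePiece-injective uv ∷ []
  edgePieceIf-injective u v false _  = []

  edgePieceIf-covers : ∀ u v b (e : adj H u v ≡ b) → adj H u v ≡ true →
                       Any (λ p → Covers p u v) (edgePieceIf u v b e)
  edgePieceIf-covers u v true  _ _  = here (zero , suc zero , refl , refl , refl)
  edgePieceIf-covers u v false e uv = contradiction (trans (sym uv) e) λ ()

  edgePieces : List (Fin (size H) × Fin (size H)) → List (Piece 𝒢 H)
  edgePieces = concatMap (λ (u , v) → edgePieceIf u v (adj H u v) refl)

  allPairs : List (Fin (size H) × Fin (size H))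
  allPairs = cartesianProduct (allFin (size H)) (allFin (size H))

  edgeCover : Cover 𝒢 H
  edgeCover = record
    { pieces = edgePieces allPairs
    ; surj   = λ u v uv → Anyₚ.concatMap⁺ _ (Any.map (λ { refl → edgePieceIf-covers u v _ refl uv })
                                                    (∈-cartesianProduct⁺ (∈-allFin u) (∈-allFin v)))
    }

  injLocalCover : ∃[ s ] HasInjLocalCover 𝒢 H s
  injLocalCover = sumFin (preimageSize (pieces edgeCover)) , edgeCover
                , Allₚ.concat⁺ (Allₚ.map⁺ (universal (λ (u , v) → edgePieceIf-injective u v _ refl)
                                                     allPairs))
                , term≤sumFin (preimageSize (pieces edgeCover))

¬¬-least : (P : ℕ → Set) → ∀ {n} → P n → ¬ ¬ (∃[ m ] (P m × (∀ k → P k → m ≤ k)))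
¬¬-least P {n} Pn noLeast = <-rec (λ m → ¬ P m) notBelow n Pn
  where
  notBelow : ∀ m → (∀ {k} → k < m → ¬ P k) → ¬ P m
  notBelow m below Pm = noLeast (m , Pm , λ k Pk → ≮⇒≥ (λ k<m → below k<m Pk))

boundedOn≤ : ∀ (f : ℕ → ℕ) n → ∃[ M ] (∀ b → b ≤ n → f b ≤ M)
boundedOn≤ f zero    = f 0 , λ { zero z≤n → ≤-refl }
boundedOn≤ f (suc n) with boundedOn≤ f n
... | M , f≤M = f (suc n) ⊔ M , bound
  where
  bound : ∀ b → b ≤ suc n → f b ≤ f (suc n) ⊔ M
  bound b b≤1+n with m≤n⇒m<n∨m≡n b≤1+n
  ... | inj₁ b<1+n = m≤n⇒m≤o⊔n (f (suc n)) (f≤M b (≤-pred b<1+n))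
  ... | inj₂ refl  = m≤m⊔n (f (suc n)) M

-- c_f(H) and c_l(H) are least elements, which exist only classically; as the goal is a negation,
-- ¬¬-least is enough.
¬LFBounded : ∀ {𝒢 ℋ} → 𝒢 K2 → ∀ c →
  (∀ M → ∃[ H ] (ℋ H × HasLocalCover 𝒢 H c × (∀ s → HasInjLocalCover 𝒢 H s → M < s))) →
  ¬ LFBounded 𝒢 ℋ
¬LFBounded {𝒢} 𝒢K2 c unbounded (f , bounded) with boundedOn≤ f c
... | M , f≤M with unbounded M
... | H , ℋH , cover-c , large =
  ¬¬-least (HasLocalCover 𝒢 H) cover-c λ (b , cover , b-least) →
  ¬¬-least (HasInjLocalCover 𝒢 H) (proj₂ (EdgeCover.injLocalCover 𝒢K2 H)) λ (a , injCover , a-least) →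
  let a≤fb = proj₂ (bounded H ℋH a b (injCover , a-least) (cover , b-least))
  in  <⇒≱ (large a injCover) (≤-trans a≤fb (f≤M b (b-least c cover-c)))

-- Bipartite covers of complete graphs

PartialColouring : ℕ → Set
PartialColouring n = (Fin n → Bool) × (Fin n → Fin 2)

Separates : ∀ {n} → PartialColouring n → Fin n → Fin n → Set
Separates (I , side) u v = I u ≡ true × I v ≡ true × ¬ side u ≡ side v

weight : ∀ {n} → List (PartialColouring n) → Fin n → ℕ
weight []             u = 1
weight ((I , _) ∷ σs) u = (if I u then 1 else 2) * weight σs u

sumOn : ∀ {n} → (Fin n → Bool) → (Fin n → ℕ) → ℕ
sumOn U w = sumFin (λ u → if U u then w u else 0)

compatible : ∀ {n} → PartialColouring n → Fin 2 → Fin n → Bool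
compatible (I , side) c u = not (I u) ∨ ⌊ side u ≟ c ⌋

-- Kraft's inequality: split U into the vertices compatible with colour zero and with colour one of the
-- first σ; both halves stay separated by the remaining σs, and vertices outside the domain of σ fall
-- into both halves, which their factor 2 in weight pays for.
kraft : ∀ {n} (σs : List (PartialColouring n)) (U : Fin n → Bool) →
        (∀ u v → U u ≡ true → U v ≡ true → ¬ u ≡ v → Any (λ σ → Separates σ u v) σs) →
        sumOn U (weight σs) ≤ 2 ^ length σs
kraft [] U separated = countFin≤1 U λ u v Uu Uv →
  decidable-stable (u ≟ v) (λ u≢v → case (separated u v Uu Uv u≢v))
  where
  case : ∀ {u v} → ¬ Any (λ σ → Separates σ u v) []
  case ()
kraft (σ@(I , side) ∷ σs) U separated = begin
  sumOn U (weight (σ ∷ σs))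
    ≡⟨ trans (sumFin-cong split) (sumFin-+ (restricted zero) (restricted (suc zero))) ⟩
  sumOn (U ∧ᶜ zero) (weight σs) + sumOn (U ∧ᶜ suc zero) (weight σs)
    ≤⟨ +-mono-≤ (kraft σs _ (separated′ zero)) (kraft σs _ (separated′ (suc zero))) ⟩
  2 ^ length σs + 2 ^ length σs
    ≡⟨ cong (2 ^ length σs +_) (sym (+-identityʳ _)) ⟩
  2 ^ length (σ ∷ σs) ∎
  where
  open ≤-Reasoning
  _∧ᶜ_ : (Fin _ → Bool) → Fin 2 → Fin _ → Bool
  (U ∧ᶜ c) u = U u ∧ compatible σ c u
  restricted : Fin 2 → Fin _ → ℕ
  restricted c u = if (U ∧ᶜ c) u then weight σs u else 0
  split : ∀ u → (if U u then weight (σ ∷ σs) u else 0)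
              ≡ (if (U ∧ᶜ zero) u then weight σs u else 0) + (if (U ∧ᶜ suc zero) u then weight σs u else 0)
  split u with U u | I u | side u
  ... | false | _     | _        = refl
  ... | true  | false | _        = cong (weight σs u +_) (+-identityʳ _)
  ... | true  | true  | zero     = refl
  ... | true  | true  | suc zero = +-identityʳ _
  sameSide : ∀ c {u} → I u ≡ true → compatible σ c u ≡ true → side u ≡ c
  sameSide c {u} Iu comp rewrite Iu = ⌊⌋⇒ (side u ≟ c) comp
  separated′ : ∀ c u v → (U ∧ᶜ c) u ≡ true → (U ∧ᶜ c) v ≡ true → ¬ u ≡ v →
               Any (λ σ → Separates σ u v) σs
  separated′ c u v Uu Uv u≢v with separated u v (∧-conicalˡ _ _ Uu) (∧-conicalˡ _ _ Uv) u≢v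
  ... | here (Iu , Iv , sides≢) =
    contradiction (trans (sameSide c Iu (∧-conicalʳ (U u) _ Uu)) (sym (sameSide c Iv (∧-conicalʳ (U v) _ Uv))))
                  sides≢
  ... | there rest = rest

Bipartite : Class
Bipartite G = Colourable G 2

Bipartite-K2 : Bipartite K2
Bipartite-K2 = (λ i → i) , proper
  where
  proper : ∀ i j → adj K2 i j ≡ true → ¬ i ≡ j
  proper zero       (suc zero) _ ()
  proper (suc zero) zero       _ ()

Bipartite-monotone : Monotone Bipartite
Bipartite-monotone G H (col , proper) (f , _ , f-hom) = col ∘ f , λ i j ij → proper (f i) (f j) (f-hom i j ij)

≢ᵇ-sym : ∀ {n} (i j : Fin n) → not ⌊ i ≟ j ⌋ ≡ not ⌊ j ≟ i ⌋
≢ᵇ-sym i j with i ≟ j | j ≟ i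
... | yes _   | yes _   = refl
... | no  _   | no  _   = refl
... | yes i≡j | no  j≢i = contradiction (sym i≡j) j≢i
... | no  i≢j | yes j≡i = contradiction (sym j≡i) i≢j

Complete : ℕ → Graph
Complete n = record
  { size   = n
  ; adj    = λ i j → not ⌊ i ≟ j ⌋
  ; sym    = ≢ᵇ-sym
  ; irrefl = λ i → cong not (⌊⌋-true (i ≟ i) refl)
  }

module DoubleCover (n : ℕ) where

  crossAdj : Fin n ⊎ Fin n → Fin n ⊎ Fin n → Bool
  crossAdj (inj₁ i) (inj₂ j) = not ⌊ i ≟ j ⌋
  crossAdj (inj₂ i) (inj₁ j) = not ⌊ i ≟ j ⌋
  crossAdj _        _        = false

  crossAdj-sym : ∀ a b → crossAdj a b ≡ crossAdj b a
  crossAdj-sym (inj₁ i) (inj₂ j) = ≢ᵇ-sym i j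
  crossAdj-sym (inj₂ i) (inj₁ j) = ≢ᵇ-sym i j
  crossAdj-sym (inj₁ _) (inj₁ _) = refl
  crossAdj-sym (inj₂ _) (inj₂ _) = refl

  crossAdj-irrefl : ∀ a → crossAdj a a ≡ false
  crossAdj-irrefl (inj₁ _) = refl
  crossAdj-irrefl (inj₂ _) = refl

  forget : Fin n ⊎ Fin n → Fin n
  forget = [ id , id ]′

  layer : Fin n ⊎ Fin n → Fin 2
  layer = [ const zero , const (suc zero) ]′

  forget-hom : ∀ a b → crossAdj a b ≡ true → not ⌊ forget a ≟ forget b ⌋ ≡ true
  forget-hom (inj₁ i) (inj₂ j) ij = ij
  forget-hom (inj₂ i) (inj₁ j) ij = ij

  layer-proper : ∀ a b → crossAdj a b ≡ true → ¬ layer a ≡ layer b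
  layer-proper (inj₁ i) (inj₂ j) _ ()
  layer-proper (inj₂ i) (inj₁ j) _ ()

  doubleCover : Graph
  doubleCover = record
    { size   = n + n
    ; adj    = λ x y → crossAdj (splitAt n x) (splitAt n y)
    ; sym    = λ x y → crossAdj-sym (splitAt n x) (splitAt n y)
    ; irrefl = λ x → crossAdj-irrefl (splitAt n x)
    }

  piece : Piece Bipartite (Complete n)
  piece = record
    { G   = doubleCover
    ; mem = (λ x → layer (splitAt n x)) , (λ x y → layer-proper (splitAt n x) (splitAt n y))
    ; φ   = λ x → forget (splitAt n x)
    ; hom = λ x y → forget-hom (splitAt n x) (splitAt n y)
    }

  localCover : HasLocalCover Bipartite (Complete n) 2
  localCover = record { pieces = piece ∷ [] ; surj = covered } , local
    where
    covered : ∀ u v → not ⌊ u ≟ v ⌋ ≡ true → Any (λ p → Covers p u v) (piece ∷ [])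
    covered u v uv = here (u ↑ˡ n , n ↑ʳ v
      , subst₂ (λ s t → crossAdj s t ≡ true) (sym (splitAt-↑ˡ n u n)) (sym (splitAt-↑ʳ n n v)) uv
      , cong forget (splitAt-↑ˡ n u n) , cong forget (splitAt-↑ʳ n n v))
    once : ∀ v → countFin (λ i → ⌊ i ≟ v ⌋) ≤ 1
    once v = countFin≤1 _ (λ a b p q → trans (⌊⌋⇒ (a ≟ v) p) (sym (⌊⌋⇒ (b ≟ v) q)))
    local : ∀ v → fibreSize piece v + 0 ≤ 2
    local v = begin
      fibreSize piece v + 0
        ≡⟨ +-identityʳ _ ⟩
      sumFin (λ x → 𝟙 ⌊ forget (splitAt n x) ≟ v ⌋)
        ≡⟨ sumFin-splitAt n _ ⟩
      sumFin (λ i → 𝟙 ⌊ forget (splitAt n (i ↑ˡ n)) ≟ v ⌋)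
        + sumFin (λ j → 𝟙 ⌊ forget (splitAt n (n ↑ʳ j)) ≟ v ⌋)
        ≡⟨ cong₂ _+_ (sumFin-cong (λ i → cong (λ z → 𝟙 ⌊ forget z ≟ v ⌋) (splitAt-↑ˡ n i n)))
                     (sumFin-cong (λ j → cong (λ z → 𝟙 ⌊ forget z ≟ v ⌋) (splitAt-↑ʳ n n j))) ⟩
      countFin (λ i → ⌊ i ≟ v ⌋) + countFin (λ j → ⌊ j ≟ v ⌋)
        ≤⟨ +-mono-≤ (once v) (once v) ⟩
      2 ∎
      where open ≤-Reasoning

module CompleteInjectiveCover {n : ℕ} where

  BipartitePiece : Set
  BipartitePiece = Piece Bipartite (Complete n)

  image? : (p : BipartitePiece) → ∀ u → Dec (∃ λ x → φ p x ≡ u)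
  image? p u = any? (λ x → φ p x ≟ u)

  sideOf : (p : BipartitePiece) → ∀ {u} → Dec (∃ λ x → φ p x ≡ u) → Fin 2
  sideOf p (yes (x , _)) = proj₁ (mem p) x
  sideOf p (no _)        = zero

  partialColouring : BipartitePiece → PartialColouring n
  partialColouring p = (λ u → ⌊ image? p u ⌋) , (λ u → sideOf p (image? p u))

  sideOf-image : ∀ p → InjectivePiece p → ∀ {x u} → φ p x ≡ u →
                 (d : Dec (∃ λ x → φ p x ≡ u)) → sideOf p d ≡ proj₁ (mem p) x
  sideOf-image p φ-inj φx≡u (yes (x′ , φx′≡u)) = cong (proj₁ (mem p)) (φ-inj (trans φx′≡u (sym φx≡u)))
  sideOf-image p φ-inj φx≡u (no none)          = contradiction (_ , φx≡u) none

  partialColouring-separates : ∀ p → InjectivePiece p → ∀ {u v} → Covers p u v →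
                               Separates (partialColouring p) u v
  partialColouring-separates p φ-inj {u} {v} (x , y , xy , φx≡u , φy≡v) =
    ⌊⌋-true (image? p u) (x , φx≡u) , ⌊⌋-true (image? p v) (y , φy≡v) ,
    λ sides≡ → proj₂ (mem p) x y xy
      (trans (sym (sideOf-image p φ-inj φx≡u (image? p u)))
             (trans sides≡ (sideOf-image p φ-inj φy≡v (image? p v))))

  separated : ∀ ps → All InjectivePiece ps → ∀ {u v} →
              Any (λ p → Covers p u v) ps → Any (λ σ → Separates σ u v) (map partialColouring ps)
  separated (p ∷ ps) (p-inj ∷ _)   (here c)  = here (partialColouring-separates p p-inj c)
  separated (p ∷ ps) (_     ∷ inj) (there c) = there (separated ps inj c)

  imageCount : List BipartitePiece → Fin n → ℕ
  imageCount ps u = sumList ps (λ p → 𝟙 ⌊ image? p u ⌋)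

  weight*2^imageCount : ∀ ps u → weight (map partialColouring ps) u * 2 ^ imageCount ps u ≡ 2 ^ length ps
  weight*2^imageCount []       u = refl
  weight*2^imageCount (p ∷ ps) u with ⌊ image? p u ⌋
  ... | true  = begin
    (1 * w) * (2 * 2 ^ d)   ≡⟨ cong (_* (2 * 2 ^ d)) (*-identityˡ w) ⟩
    w * (2 * 2 ^ d)         ≡⟨ x∙yz≈y∙xz w 2 (2 ^ d) ⟩
    2 * (w * 2 ^ d)         ≡⟨ cong (2 *_) (weight*2^imageCount ps u) ⟩
    2 * 2 ^ length ps       ∎
    where
    open ≡-Reasoning
    w = weight (map partialColouring ps) u
    d = imageCount ps u
  ... | false = trans (*-assoc 2 (weight (map partialColouring ps) u) _) (cong (2 *_) (weight*2^imageCount ps u))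

  imageCount≤preimageSize : ∀ ps u → imageCount ps u ≤ preimageSize ps u
  imageCount≤preimageSize []       u = z≤n
  imageCount≤preimageSize (p ∷ ps) u = +-mono-≤ inImage (imageCount≤preimageSize ps u)
    where
    inImage : 𝟙 ⌊ image? p u ⌋ ≤ fibreSize p u
    inImage with image? p u
    ... | yes (x , φx≡u) = 1≤countFin _ x (⌊⌋-true (φ p x ≟ u) φx≡u)
    ... | no  _          = z≤n

  lowerBound : ∀ s → HasInjLocalCover Bipartite (Complete n) s → n ≤ 2 ^ s
  lowerBound s (C , injective , local) = *-cancelʳ-≤ n (2 ^ s) (2 ^ L) {{m^n≢0 2 L}} (begin
    n * 2 ^ L                               ≡⟨ sym (sumFin-const n (2 ^ L)) ⟩
    sumFin {n} (λ _ → 2 ^ L)                ≤⟨ sumFin-mono pointwise ⟩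
    sumFin (λ u → weight σs u * 2 ^ s)      ≡⟨ sumFin-*ʳ (weight σs) (2 ^ s) ⟩
    sumOn (λ _ → true) (weight σs) * 2 ^ s  ≤⟨ *-monoˡ-≤ (2 ^ s) (kraft σs (λ _ → true) separatedAll) ⟩
    2 ^ length σs * 2 ^ s                   ≡⟨ cong (λ m → 2 ^ m * 2 ^ s) (length-map partialColouring ps) ⟩
    2 ^ L * 2 ^ s                           ≡⟨ *-comm (2 ^ L) (2 ^ s) ⟩
    2 ^ s * 2 ^ L                           ∎)
    where
    open ≤-Reasoning
    ps = pieces C
    σs = map partialColouring ps
    L = length ps
    separatedAll : ∀ u v → true ≡ true → true ≡ true → ¬ u ≡ v → Any (λ σ → Separates σ u v) σs
    separatedAll u v _ _ u≢v = separated ps injective (surj C u v (cong not (⌊⌋-false (u ≟ v) u≢v)))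
    pointwise : ∀ u → 2 ^ L ≤ weight σs u * 2 ^ s
    pointwise u = begin
      2 ^ L                              ≡⟨ sym (weight*2^imageCount ps u) ⟩
      weight σs u * 2 ^ imageCount ps u  ≤⟨ *-monoʳ-≤ (weight σs u) (^-monoʳ-≤ 2 fewImages) ⟩
      weight σs u * 2 ^ s                ∎
      where fewImages = ≤-trans (imageCount≤preimageSize ps u) (local u)

AllGraphs : Class
AllGraphs _ = ⊤

monotoneCounterexample :
  Σ Class λ 𝒢 → Σ Class λ ℋ → 𝒢 K2 × Monotone 𝒢 × BoundedChromatic 𝒢 × ¬ LFBounded 𝒢 ℋ
monotoneCounterexample =
  Bipartite , AllGraphs , Bipartite-K2 , Bipartite-monotone , (2 , λ _ bipartite → bipartite)
  , ¬LFBounded Bipartite-K2 2 λ M →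
      Complete (suc (2 ^ M)) , tt , DoubleCover.localCover (suc (2 ^ M))
      , λ s cover → ≰⇒> λ s≤M →
          <-irrefl refl (≤-trans (CompleteInjectiveCover.lowerBound s cover) (^-monoʳ-≤ 2 s≤M))

-- Stars and K_{2,n}

EveryCherryInC4 : Class
EveryCherryInC4 G = ∀ x y z → adj G x y ≡ true → adj G x z ≡ true → ¬ y ≡ z →
                    ∃[ w ] (¬ w ≡ x × adj G y w ≡ true × adj G z w ≡ true)

EveryCherryInC4-K2 : EveryCherryInC4 K2
EveryCherryInC4-K2 zero       (suc zero) (suc zero) _ _ y≢z = contradiction refl y≢z
EveryCherryInC4-K2 (suc zero) zero       zero       _ _ y≢z = contradiction refl y≢z

EveryCherryInC4-componentClosed : ComponentClosed EveryCherryInC4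
EveryCherryInC4-componentClosed G C cherries (f , f-inj , adj≡ , closed , _) x y z xy xz y≢z
  with cherries (f x) (f y) (f z) (trans (sym (adj≡ x y)) xy) (trans (sym (adj≡ x z)) xz) (y≢z ∘ f-inj)
... | w , w≢fx , yw , zw with closed y w yw
...   | w′ , fw′≡w =
  w′ , (λ w′≡x → w≢fx (trans (sym fw′≡w) (cong f w′≡x)))
     , trans (adj≡ y w′) (subst (λ t → adj G (f y) t ≡ true) (sym fw′≡w) yw)
     , trans (adj≡ z w′) (subst (λ t → adj G (f z) t ≡ true) (sym fw′≡w) zw)

starAdj : ∀ {n} → Fin (suc n) → Fin (suc n) → Bool
starAdj zero    zero    = false
starAdj zero    (suc _) = true
starAdj (suc _) zero    = true
starAdj (suc _) (suc _) = false

starAdj-sym : ∀ {n} (i j : Fin (suc n)) → starAdj i j ≡ starAdj j i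
starAdj-sym zero    zero    = refl
starAdj-sym zero    (suc _) = refl
starAdj-sym (suc _) zero    = refl
starAdj-sym (suc _) (suc _) = refl

starAdj-irrefl : ∀ {n} (i : Fin (suc n)) → starAdj i i ≡ false
starAdj-irrefl zero    = refl
starAdj-irrefl (suc _) = refl

Star : ℕ → Graph
Star n = record { size = suc n ; adj = starAdj ; sym = starAdj-sym ; irrefl = starAdj-irrefl }

hubAdj : ∀ {n} → Fin (suc (suc n)) → Fin (suc (suc n)) → Bool
hubAdj zero          (suc (suc _)) = true
hubAdj (suc zero)    (suc (suc _)) = true
hubAdj (suc (suc _)) zero          = true
hubAdj (suc (suc _)) (suc zero)    = true
hubAdj _             _             = false

hubAdj-sym : ∀ {n} (i j : Fin (suc (suc n))) → hubAdj i j ≡ hubAdj j i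
hubAdj-sym zero          zero          = refl
hubAdj-sym zero          (suc zero)    = refl
hubAdj-sym zero          (suc (suc _)) = refl
hubAdj-sym (suc zero)    zero          = refl
hubAdj-sym (suc zero)    (suc zero)    = refl
hubAdj-sym (suc zero)    (suc (suc _)) = refl
hubAdj-sym (suc (suc _)) zero          = refl
hubAdj-sym (suc (suc _)) (suc zero)    = refl
hubAdj-sym (suc (suc _)) (suc (suc _)) = refl

hubAdj-irrefl : ∀ {n} (i : Fin (suc (suc n))) → hubAdj i i ≡ false
hubAdj-irrefl zero          = refl
hubAdj-irrefl (suc zero)    = refl
hubAdj-irrefl (suc (suc _)) = refl

-- K_{2,n}, with hubs zero and suc zero.
CompleteBipartite₂ : ℕ → Graph
CompleteBipartite₂ n = record { size = suc (suc n) ; adj = hubAdj ; sym = hubAdj-sym ; irrefl = hubAdj-irrefl }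

otherLeaf : ∀ {m} → Fin (suc (suc m)) → Fin (suc (suc m))
otherLeaf zero    = suc zero
otherLeaf (suc _) = zero

otherLeaf-≢ : ∀ {m} (i : Fin (suc (suc m))) → ¬ otherLeaf i ≡ i
otherLeaf-≢ zero    ()
otherLeaf-≢ (suc _) ()

EveryCherryInC4-CompleteBipartite₂ : ∀ m → EveryCherryInC4 (CompleteBipartite₂ (suc (suc m)))
EveryCherryInC4-CompleteBipartite₂ m = closes
  where
  leaf≢ : ∀ i → ¬ suc (suc (otherLeaf i)) ≡ suc (suc i)
  leaf≢ i e = otherLeaf-≢ i (suc-injective (suc-injective e))
  closes : EveryCherryInC4 (CompleteBipartite₂ (suc (suc m)))
  closes zero          (suc (suc _)) (suc (suc _)) _ _ _   = suc zero , (λ ()) , refl , refl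
  closes (suc zero)    (suc (suc _)) (suc (suc _)) _ _ _   = zero , (λ ()) , refl , refl
  closes (suc (suc i)) zero          (suc zero)    _ _ _   = suc (suc (otherLeaf i)) , leaf≢ i , refl , refl
  closes (suc (suc i)) (suc zero)    zero          _ _ _   = suc (suc (otherLeaf i)) , leaf≢ i , refl , refl
  closes (suc (suc i)) zero          zero          _ _ y≢z = contradiction refl y≢z
  closes (suc (suc i)) (suc zero)    (suc zero)    _ _ y≢z = contradiction refl y≢z
  closes zero          zero          _             () _ _
  closes zero          (suc zero)    _             () _ _
  closes zero          (suc (suc _)) zero          _ () _
  closes zero          (suc (suc _)) (suc zero)    _ () _
  closes (suc zero)    zero          _             () _ _
  closes (suc zero)    (suc zero)    _             () _ _
  closes (suc zero)    (suc (suc _)) zero          _ () _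
  closes (suc zero)    (suc (suc _)) (suc zero)    _ () _
  closes (suc (suc _)) (suc (suc _)) _             () _ _
  closes (suc (suc _)) zero          (suc (suc _)) _ () _
  closes (suc (suc _)) (suc zero)    (suc (suc _)) _ () _

mergeHubs : ∀ {n} → Fin (suc (suc n)) → Fin (suc n)
mergeHubs zero          = zero
mergeHubs (suc zero)    = zero
mergeHubs (suc (suc i)) = suc i

mergeHubs-hom : ∀ {n} x y → hubAdj {n} x y ≡ true → starAdj (mergeHubs x) (mergeHubs y) ≡ true
mergeHubs-hom zero          (suc (suc _)) _ = refl
mergeHubs-hom (suc zero)    (suc (suc _)) _ = refl
mergeHubs-hom (suc (suc _)) zero          _ = refl
mergeHubs-hom (suc (suc _)) (suc zero)    _ = refl

star-localCover : ∀ m → HasLocalCover EveryCherryInC4 (Star (suc (suc m))) 2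
star-localCover m = record { pieces = piece ∷ [] ; surj = covered } , local
  where
  piece : Piece EveryCherryInC4 (Star (suc (suc m)))
  piece = record { G = CompleteBipartite₂ (suc (suc m)) ; mem = EveryCherryInC4-CompleteBipartite₂ m
                 ; φ = mergeHubs ; hom = mergeHubs-hom }
  covered : ∀ u v → starAdj u v ≡ true → Any (λ p → Covers p u v) (piece ∷ [])
  covered zero    (suc j) _ = here (zero , suc (suc j) , refl , refl , refl)
  covered (suc i) zero    _ = here (suc (suc i) , zero , refl , refl , refl)
  local : ∀ v → fibreSize piece v + 0 ≤ 2
  local zero    = ≤-reflexive (cong (λ z → 2 + z + 0)
                    (countFin-false {suc (suc m)} (λ i → ⌊ suc i ≟ zero ⌋) (λ _ → refl)))
  local (suc j) = ≤-trans (≤-reflexive (+-identityʳ _))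
                    (m≤n⇒m≤1+n (countFin≤1 {suc (suc m)} (λ i → ⌊ suc i ≟ suc j ⌋) λ a b p q →
                      suc-injective (trans (⌊⌋⇒ (suc a ≟ suc j) p) (sym (⌊⌋⇒ (suc b ≟ suc j) q)))))

module StarInjectiveCover {n : ℕ} where

  leafCovered : Piece EveryCherryInC4 (Star n) → Fin n → Bool
  leafCovered p l = ⌊ covers? p zero (suc l) ⌋

  leafNeighbour : ∀ l t → starAdj {n} (suc l) t ≡ true → t ≡ zero
  leafNeighbour l zero _ = refl

  -- Two leaves covered by an injective piece would come from a cherry at the preimage x of the centre;
  -- the fourth vertex of its C₄ is a neighbour of a leaf other than x, yet it also maps to the centre.
  leafCovered-unique : ∀ (p : Piece EveryCherryInC4 (Star n)) → InjectivePiece p →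
                       ∀ l l′ → Covers p zero (suc l) → Covers p zero (suc l′) → l ≡ l′
  leafCovered-unique p φ-inj l l′ (x , y , xy , φx≡0 , φy≡l) (x′ , y′ , x′y′ , φx′≡0 , φy′≡l′)
    with φ-inj (trans φx≡0 (sym φx′≡0))
  ... | refl with y ≟ y′
  ...   | yes refl = suc-injective (trans (sym φy≡l) φy′≡l′)
  ...   | no  y≢y′ with mem p x y y′ xy x′y′ y≢y′
  ...     | w , w≢x , yw , _ =
    let φw≡0 = leafNeighbour l (φ p w) (subst (λ t → starAdj t (φ p w) ≡ true) φy≡l (hom p y w yw))
    in  contradiction (φ-inj (trans φw≡0 (sym φx≡0))) w≢x

  leavesCovered≤fibre : ∀ (p : Piece EveryCherryInC4 (Star n)) → InjectivePiece p →
                        countFin (leafCovered p) ≤ fibreSize p zero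
  leavesCovered≤fibre p φ-inj = countFin≤-ofSubsingleton (leafCovered p) _
    (countFin≤1 (leafCovered p) λ l l′ c c′ →
      leafCovered-unique p φ-inj l l′ (⌊⌋⇒ (covers? p zero (suc l)) c) (⌊⌋⇒ (covers? p zero (suc l′)) c′))
    (λ l c → let (x , _ , _ , φx≡0 , _) = ⌊⌋⇒ (covers? p zero (suc l)) c in x , ⌊⌋-true (φ p x ≟ zero) φx≡0)

  lowerBound : ∀ s → HasInjLocalCover EveryCherryInC4 (Star n) s → n ≤ s
  lowerBound s (C , injective , local) = begin
    n                                                      ≡⟨ sym (countFin-true n) ⟩
    sumFin {n} (λ _ → 1)                                   ≤⟨ sumFin-mono someCover ⟩
    sumFin (λ l → sumList ps (λ p → 𝟙 (leafCovered p l)))  ≡⟨ sumFin-sumList ps (λ l p → 𝟙 (leafCovered p l)) ⟩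
    sumList ps (λ p → countFin (leafCovered p))            ≤⟨ perPiece ps injective ⟩
    sumList ps (λ p → fibreSize p zero)                    ≡⟨ sym (preimageSize≡sumList ps zero) ⟩
    preimageSize ps zero                                   ≤⟨ local zero ⟩
    s                                                      ∎
    where
    open ≤-Reasoning
    ps = pieces C
    someCover : ∀ l → 1 ≤ sumList ps (λ p → 𝟙 (leafCovered p l))
    someCover l = 1≤sumList ps _ (Any.map (λ {p} c → ≤-reflexive (cong 𝟙 (sym (⌊⌋-true (covers? p _ _) c))))
                                          (surj C zero (suc l) refl))
    perPiece : ∀ qs → All InjectivePiece qs →
               sumList qs (λ p → countFin (leafCovered p)) ≤ sumList qs (λ p → fibreSize p zero)
    perPiece []       []            = z≤n
    perPiece (q ∷ qs) (q-inj ∷ inj) = +-mono-≤ (leavesCovered≤fibre q q-inj) (perPiece qs inj)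

star-walkFromCentre : ∀ {n} {P : Fin (suc n) → Set} → (∀ s → P s) → ∀ t → Walk (Star n) P zero t
star-walkFromCentre all zero    = here (all zero)
star-walkFromCentre all (suc j) = step (all zero) refl (here (all (suc j)))

star-walk : ∀ {n} {P : Fin (suc n) → Set} → (∀ s → P s) → ∀ t t′ → Walk (Star n) P t t′
star-walk all zero    t′ = star-walkFromCentre all t′
star-walk all (suc i) t′ = step (all (suc i)) refl (star-walkFromCentre all t′)

star-backtracks : ∀ {n} (a b c d : Fin (suc n)) →
                  starAdj a b ≡ true → starAdj b c ≡ true → starAdj c d ≡ true → ¬ a ≡ c → ¬ b ≡ d → ⊥
star-backtracks zero    (suc b) zero    d       _ _ _ a≢c _   = a≢c refl
star-backtracks (suc a) zero    (suc c) zero    _ _ _ _   b≢d = b≢d refl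
star-backtracks zero    (suc b) (suc c) _       _ () _ _ _
star-backtracks (suc a) zero    (suc c) (suc d) _ _ () _ _
star-backtracks (suc a) zero    zero    _       _ () _ _ _

star-acyclic : ∀ n → ¬ HasCycle (Star n)
star-acyclic n (zero , c , c-inj , path , closing) =
  star-backtracks (c zero) (c (suc zero)) (c (suc (suc zero))) (c zero)
                  (path zero) (path (suc zero)) closing
                  (λ e → contradiction (c-inj e) λ ()) (λ e → contradiction (c-inj e) λ ())
star-acyclic n (suc k , c , c-inj , path , _) =
  star-backtracks (c zero) (c (suc zero)) (c (suc (suc zero))) (c (suc (suc (suc zero))))
                  (path zero) (path (suc zero)) (path (suc (suc zero)))
                  (λ e → contradiction (c-inj e) λ ()) (λ e → contradiction (c-inj e) λ ())

starBag : ∀ {n} → Fin (suc n) → Fin (suc n) → Bool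
starBag t       zero    = true
starBag zero    (suc v) = false
starBag (suc t) (suc v) = ⌊ t ≟ v ⌋

star-treeDecomposition : ∀ n → TreeDecomposition (Star n) 1
star-treeDecomposition n = record
  { T       = Star n
  ; isTree  = star-walk (λ _ → tt) , star-acyclic n
  ; bag     = starBag
  ; vcover  = vcover
  ; ecover  = ecover
  ; subtree = subtree
  ; bagSize = bagSize
  }
  where
  vcover : ∀ v → ∃[ t ] starBag t v ≡ true
  vcover zero    = zero , refl
  vcover (suc v) = suc v , ⌊⌋-true (v ≟ v) refl
  ecover : ∀ u v → starAdj u v ≡ true → ∃[ t ] (starBag t u ≡ true × starBag t v ≡ true)
  ecover zero    (suc j) _ = suc j , refl , ⌊⌋-true (j ≟ j) refl
  ecover (suc i) zero    _ = suc i , ⌊⌋-true (i ≟ i) refl , refl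
  subtree : ∀ v t t′ → starBag t v ≡ true → starBag t′ v ≡ true →
            Walk (Star n) (λ s → starBag s v ≡ true) t t′
  subtree zero    t       t′       _  _ = star-walk (λ _ → refl) t t′
  subtree (suc j) (suc i) (suc i′) b  b′ with ⌊⌋⇒ (i ≟ j) b | ⌊⌋⇒ (i′ ≟ j) b′
  ... | refl | refl = here b
  bagSize : ∀ t → countFin (starBag t) ≤ 2
  bagSize zero    = s≤s (≤-trans (≤-reflexive (countFin-false {n} _ (λ _ → refl))) z≤n)
  bagSize (suc i) = s≤s (countFin≤1 (λ v → ⌊ i ≟ v ⌋) λ a b p q → trans (sym (⌊⌋⇒ (i ≟ a) p)) (⌊⌋⇒ (i ≟ b) q))

Stars : Class
Stars H = ∃[ n ] H ≡ Star n

componentClosedCounterexample :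
  Σ Class λ 𝒢 → Σ Class λ ℋ → 𝒢 K2 × ComponentClosed 𝒢 × BoundedTreewidth ℋ × ¬ LFBounded 𝒢 ℋ
componentClosedCounterexample =
  EveryCherryInC4 , Stars , EveryCherryInC4-K2 , EveryCherryInC4-componentClosed
  , (1 , λ { _ (n , refl) → star-treeDecomposition n })
  , ¬LFBounded EveryCherryInC4-K2 2 λ M →
      Star (2 + M) , (2 + M , refl) , star-localCover M
      , λ s cover → ≤-trans (n≤1+n (suc M)) (StarInjectiveCover.lowerBound s cover)

theorem4 :
    ((𝒢 ℋ : Class) → 𝒢 K2 → Hereditary 𝒢 → BoundedMad 𝒢 → LFBounded 𝒢 ℋ)
    × ((𝒢 ℋ : Class) → 𝒢 K2 → Hereditary 𝒢 → BoundedChromatic ℋ → LFBounded 𝒢 ℋ)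
    × Σ Class (λ 𝒢 → Σ Class (λ ℋ →
        𝒢 K2 × Monotone 𝒢 × BoundedChromatic 𝒢 × ¬ LFBounded 𝒢 ℋ))
    × Σ Class (λ 𝒢 → Σ Class (λ ℋ →
        𝒢 K2 × ComponentClosed 𝒢 × BoundedTreewidth ℋ × ¬ LFBounded 𝒢 ℋ))
theorem4 =
  -- K₂ ∈ 𝒢 only makes c_l finite; LFBounded constrains c_l where it exists, so (1) and (2) ignore it.
    (λ 𝒢 ℋ _ → lfBounded-ofBoundedMad 𝒢 ℋ)
  , (λ 𝒢 ℋ _ → lfBounded-ofBoundedChromatic 𝒢 ℋ)
  , monotoneCounterexample
  , componentClosedCounterexample
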